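{- Let $\Phi$ be an irreducible root system of rank $\ell$, and let $\hat c_0,\dots,\hat c_{\hat\ell}$ be the distinct integers among $c_0,\dots,c_\ell$. For each $k\in\{\hat c_0,\dots,\hat c_{\hat\ell}\}$ let $\ell_k+1$ be the number of indices $i\in\{0,\dots,\ell\}$ such that $c_i$ is a multiple of $k$. Then there exist quasi-polynomials $\mathrm{L}_k^{(\ell_k)}$, $k\in\{\hat c_0,\dots,\hat c_{\hat\ell}\}$, such that $\mathrm{L}_k^{(\ell_k)}$ has period $k$ and degree $\ell_k$, and \[ \mathrm{L}_\Phi(t)=\sum_{k\in\{\hat c_0,\dots,\hat c_{\hat\ell}\}}\mathrm{L}_k^{(\ell_k)}(t). \]
   Context: $\Phi\subset V=\mathbb{R}^\ell$ is an irreducible crystallographic root system with positive system $\Phi^+$, simple roots $\alpha_1,\dots,\alpha_\ell$, highest root $\tilde\alpha=\sum_{i=1}^\ell c_i\alpha_i$, $c_0:=1$; $Z(\Phi)=\{x\in V:(\alpha_i,x)\in\mathbb{Z}\ \forall i\}$. A quasi-polynomial is a function $\mathbb{Z}\to\mathbb{C}$ for which there exist a positive integer $N$ (a period) and polynomials $g_1,\dots,g_N$ (constituents) with $g(t)=g_j(t)$ for $t\equiv j\bmod N$; its degree is $\max_j\deg g_j$. $\mathrm{L}_\Phi$ is the Ehrhart quasi-polynomial of the closed fundamental alcove, $\mathrm{L}_\Phi(q)=\#\{x\in Z(\Phi):(\alpha_i,x)\ge0\ (1\le i\le\ell),\ (\tilde\alpha,x)\le q\}$ for $q\in\mathbb{Z}_{>0}$;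 its generating function is $\sum_{q\ge0}\mathrm{L}_\Phi(q)x^q=\prod_{i=0}^\ell(1-x^{c_i})^{ -1}$. -}

module Defs where

open import Data.Nat as ℕ using (ℕ; zero; suc; _≤_; _<_; _≤?_)
open import Data.Nat.Divisibility using (_∣_; _∣?_)
open import Data.Integer as ℤ using (ℤ; +_)
open import Data.Rational as ℚ using (ℚ; 0ℚ; _/_)
open import Data.Fin using (Fin; toℕ)
open import Data.List as List using (List; []; _∷_; length; filter; map; deduplicate; concatMap; upTo)
open import Data.List.Membership.Propositional using (_∈_)
open import Data.Vec as Vec using (Vec; []; _∷_)
open import Data.Product using (Σ; _×_; ∃; ∃-syntax)
open import Relation.Binary.PropositionalEquality using (_≡_; _≢_)

-- Irreducible (crystallographic) root systems, up to isomorphism,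
-- given by their Cartan–Killing type (classification), rank ℓ.
-- A n : A_{n+1} (ℓ ≥ 1), B n : B_{n+2} (ℓ ≥ 2), C n : C_{n+3} (ℓ ≥ 3),
-- D n : D_{n+4} (ℓ ≥ 4), and the exceptional types.

data RootSystem : Set where
  A B C D : ℕ → RootSystem
  E6 E7 E8 F4 G2 : RootSystem

rank : RootSystem → ℕ
rank (A n) = suc n
rank (B n) = 2 ℕ.+ n
rank (C n) = 3 ℕ.+ n
rank (D n) = 4 ℕ.+ n
rank E6 = 6
rank E7 = 7
rank E8 = 8
rank F4 = 4
rank G2 = 2

replicate : (n : ℕ) → ℕ → Vec ℕ n
replicate n x = Vec.replicate n x

cTail : (n : ℕ) → Vec ℕ (suc n)
cTail zero = 1 ∷ []
cTail (suc n) = 2 ∷ cTail n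

dTail : (n : ℕ) → Vec ℕ (3 ℕ.+ n)
dTail zero = 2 ∷ 1 ∷ 1 ∷ []
dTail (suc n) = 2 ∷ dTail n

-- Coefficients c_1, …, c_ℓ of the highest root in the simple roots
-- (Bourbaki numbering).
highestCoeffs : (Φ : RootSystem) → Vec ℕ (rank Φ)
highestCoeffs (A n) = replicate (suc n) 1
highestCoeffs (B n) = 1 ∷ replicate (suc n) 2
highestCoeffs (C n) = 2 ∷ 2 ∷ cTail n
highestCoeffs (D n) = 1 ∷ dTail n
highestCoeffs E6 = 1 ∷ 2 ∷ 2 ∷ 3 ∷ 2 ∷ 1 ∷ []
highestCoeffs E7 = 2 ∷ 2 ∷ 3 ∷ 4 ∷ 3 ∷ 2 ∷ 1 ∷ []
highestCoeffs E8 = 2 ∷ 3 ∷ 4 ∷ 6 ∷ 5 ∷ 4 ∷ 3 ∷ 2 ∷ []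
highestCoeffs F4 = 2 ∷ 3 ∷ 4 ∷ 2 ∷ []
highestCoeffs G2 = 3 ∷ 2 ∷ []

coeffs : (Φ : RootSystem) → List ℕ
coeffs Φ = 1 ∷ Vec.toList (highestCoeffs Φ)

-- Ehrhart quasi-polynomial of the closed fundamental alcove.
-- A point x ∈ Z(Φ) is determined by the integers n_i = (α_i , x);
-- the alcove conditions read n_i ≥ 0 and Σ c_i n_i = (α̃ , x) ≤ q.

box : (ℓ : ℕ) → ℕ → List (Vec ℕ ℓ)
box zero q = [] ∷ []
box (suc ℓ) q = concatMap (λ m → map (m ∷_) (box ℓ q)) (upTo (suc q))

dot : {ℓ : ℕ} → Vec ℕ ℓ → Vec ℕ ℓ → ℕ
dot [] [] = 0
dot (c ∷ cs) (n ∷ ns) = c ℕ.* n ℕ.+ dot cs ns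

-- L_Φ(q) = #{ x ∈ Z(Φ) : (α_i,x) ≥ 0, (α̃,x) ≤ q }
-- (entries of such n are automatically ≤ q since all c_i ≥ 1)
L : RootSystem → ℕ → ℕ
L Φ q = length (filter (λ n → dot (highestCoeffs Φ) n ≤? q) (box (rank Φ) q))

Poly : Set
Poly = List ℚ

coeff : Poly → ℕ → ℚ
coeff [] i = 0ℚ
coeff (a ∷ p) zero = a
coeff (a ∷ p) (suc i) = coeff p i

eval : Poly → ℤ → ℚ
eval [] t = 0ℚ
eval (a ∷ p) t = a ℚ.+ (t / 1) ℚ.* eval p t

IsConstituents : (g : ℤ → ℚ) (N : ℕ) → (Fin N → Poly) → Set
IsConstituents g N h = ∀ (j : Fin N) (m : ℤ) →
  g ((+ toℕ j) ℤ.+ (+ N) ℤ.* m) ≡ eval (h j) ((+ toℕ j) ℤ.+ (+ N) ℤ.* m)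

MaxDegree : {N : ℕ} → (Fin N → Poly) → ℕ → Set
MaxDegree {N} h d = (∀ (j : Fin N) (i : ℕ) → d < i → coeff (h j) i ≡ 0ℚ)
                  × (∃[ j ] coeff (h j) d ≢ 0ℚ)

QuasiPoly : (g : ℤ → ℚ) (N d : ℕ) → Set
QuasiPoly g N d = 0 < N × (∃[ h ] (IsConstituents g N h × MaxDegree h d))

distinctCoeffs : RootSystem → List ℕ
distinctCoeffs Φ = deduplicate ℕ._≟_ (coeffs Φ)

ℓ[_]_ : RootSystem → ℕ → ℕ
ℓ[ Φ ] k = length (filter (k ∣?_) (coeffs Φ)) ℕ.∸ 1

sumℚ : List ℚ → ℚ
sumℚ = List.foldr ℚ._+_ 0ℚ

-- Extend L_Φ by zero to negative t and write E f t = f (t - 1). Peeling off one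
-- coefficient at a time, the operator ∏_{i=0}^ℓ (1 - E^{c_i}) sends this extension to
-- the indicator of t = 0, and it kills every quasi-polynomial of period k whose degree
-- is less than the number of c_i divisible by k.
--
-- For the exceptional types the candidate parts are therefore checked on a window of
-- Σ c_i consecutive integers, beyond which both sides obey the same recurrence.
-- For the classical types every c_i is 1 or 2, and L_Φ is (1 + E)^a applied to
-- t ↦ [t even] binom(t/2 + ℓ, ℓ), where a = 1 + #{i ≥ 1 : c_i = 1}; writing
-- [t even] = (1 + (-1)^t)/2 splits it into a polynomial of degree ℓ and (-1)^t times
-- a polynomial of degree ℓ - a = ℓ_2.

module Submission where

import Algebra.Properties.CommutativeSemigroup
import Algebra.Properties.Group
open import Algebra.Bundles using (AbelianGroup)
open import Data.Fin as Fin using (Fin; zero; suc; toℕ)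
import Data.Fin.Properties as Finₚ
open import Data.Integer as ℤ using (ℤ; +_; -[1+_])
open import Data.Integer.DivMod using (_%ℕ_; _/ℕ_; n%ℕd<d; a≡a%ℕn+[a/ℕn]*n)
import Data.Integer.Properties as ℤₚ
open import Data.List using (List; []; _∷_; length; filter; map; concat; upTo; applyUpTo; _++_; deduplicate)
open import Data.List.Membership.Propositional using (_∈_)
open import Data.List.Membership.Propositional.Properties using (∈-filter⁺; ∈-deduplicate⁻)
import Data.List.Properties as Listₚ
open import Data.List.Relation.Unary.All as ListAll using ([]; _∷_)
open import Data.List.Relation.Unary.Any using (here; there)
open import Data.Nat as ℕ using (ℕ; zero; suc; z≤n; s≤s; _≤_; _<_; _≤?_; NonZero)
open import Data.Nat.Coprimality as Coprimality using (1-coprimeTo)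
open import Data.Nat.Divisibility using (_∣_; _∣?_; divides; ∣-refl; 1∣_)
import Data.Nat.DivMod as DivMod
open import Data.Nat.Induction using (<-rec)
open import Data.Nat.ListAction using (sum)
import Data.Nat.Properties as ℕₚ
open import Data.Product using (_×_; _,_; proj₁; proj₂; ∃-syntax; Σ-syntax)
open import Data.Rational as ℚ using (ℚ; 0ℚ; 1ℚ; mkℚ; _/_; _+_; _-_; _*_; -_; Positive)
import Data.Rational.Properties as ℚₚ
open import Data.Rational.Solver using (module +-*-Solver)
import Data.Rational.Unnormalised as ℚᵘ
import Data.Rational.Unnormalised.Properties as ℚᵘₚ
open import Data.Sum using (_⊎_; inj₁; inj₂)
open import Data.Vec as Vec using (Vec; []; _∷_)
import Data.Vec.Properties as Vecₚ
open import Data.Vec.Relation.Unary.All as VecAll using ([]; _∷_)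
import Data.Vec.Relation.Unary.All.Properties as VecAllₚ
open import Function using (_∘_)
open import Relation.Binary.PropositionalEquality
open import Relation.Nullary using (Dec; yes; no; ¬_; ¬?; _×-dec_)
open import Relation.Nullary.Decidable using (True; toWitness)
open import Relation.Nullary.Negation using (contradiction)
open import Relation.Unary using (Decidable)

open import Defs

open +-*-Solver
module ℤ-Comm = Algebra.Properties.CommutativeSemigroup ℤₚ.+-commutativeSemigroup
module ℤ-Group = Algebra.Properties.Group (AbelianGroup.group ℤₚ.+-0-abelianGroup)
module ℚ-Group = Algebra.Properties.Group ℚₚ.+-0-group

fromℤ : ℤ → ℚ
fromℤ t = t / 1

fromℕ : ℕ → ℚ
fromℕ n = fromℤ (+ n)

fromℤ≡mkℚ : ∀ t → fromℤ t ≡ mkℚ t 0 (Coprimality.sym (1-coprimeTo ℤ.∣ t ∣))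
fromℤ≡mkℚ (+ n)    = ℚₚ.normalize-coprime (Coprimality.sym (1-coprimeTo n))
fromℤ≡mkℚ -[1+ n ] = cong -_ (ℚₚ.normalize-coprime (Coprimality.sym (1-coprimeTo (suc n))))

toℚᵘ-fromℤ : ∀ t → ℚ.toℚᵘ (fromℤ t) ≡ ℚᵘ.mkℚᵘ t 0
toℚᵘ-fromℤ t rewrite fromℤ≡mkℚ t = refl

fromℤ-+ : ∀ a b → fromℤ (a ℤ.+ b) ≡ fromℤ a + fromℤ b
fromℤ-+ a b = ℚₚ.toℚᵘ-injective (begin
  ℚ.toℚᵘ (fromℤ (a ℤ.+ b))              ≡⟨ toℚᵘ-fromℤ (a ℤ.+ b) ⟩
  ℚᵘ.mkℚᵘ (a ℤ.+ b) 0                   ≈⟨ ℚᵘ.*≡* (trans (ℤₚ.*-identityʳ (a ℤ.+ b)) (sym (trans (ℤₚ.*-identityʳ _) (cong₂ ℤ._+_ (ℤₚ.*-identityʳ a) (ℤₚ.*-identityʳ b))))) ⟩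
  ℚᵘ.mkℚᵘ a 0 ℚᵘ.+ ℚᵘ.mkℚᵘ b 0          ≡⟨ sym (cong₂ ℚᵘ._+_ (toℚᵘ-fromℤ a) (toℚᵘ-fromℤ b)) ⟩
  ℚ.toℚᵘ (fromℤ a) ℚᵘ.+ ℚ.toℚᵘ (fromℤ b) ≈⟨ ℚᵘₚ.≃-sym (ℚₚ.toℚᵘ-homo-+ (fromℤ a) (fromℤ b)) ⟩
  ℚ.toℚᵘ (fromℤ a + fromℤ b)            ∎)
  where open ℚᵘₚ.≃-Reasoning

fromℤ-neg : ∀ a → fromℤ (ℤ.- a) ≡ - fromℤ a
fromℤ-neg a = ℚₚ.toℚᵘ-injective (begin
  ℚ.toℚᵘ (fromℤ (ℤ.- a))   ≡⟨ toℚᵘ-fromℤ (ℤ.- a) ⟩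
  ℚᵘ.- ℚᵘ.mkℚᵘ a 0         ≡⟨ cong ℚᵘ.-_ (sym (toℚᵘ-fromℤ a)) ⟩
  ℚᵘ.- ℚ.toℚᵘ (fromℤ a)    ≈⟨ ℚᵘₚ.≃-sym (ℚₚ.toℚᵘ-homo‿- (fromℤ a)) ⟩
  ℚ.toℚᵘ (- fromℤ a)       ∎)
  where open ℚᵘₚ.≃-Reasoning

fromℤ-- : ∀ a b → fromℤ (a ℤ.- b) ≡ fromℤ a - fromℤ b
fromℤ-- a b = trans (fromℤ-+ a (ℤ.- b)) (cong (λ x → fromℤ a + x) (fromℤ-neg b))

fromℕ-+ : ∀ m n → fromℕ (m ℕ.+ n) ≡ fromℕ m + fromℕ n
fromℕ-+ m n = trans (cong fromℤ (ℤₚ.pos-+ m n)) (fromℤ-+ (+ m) (+ n))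

1/suc : ℕ → ℚ
1/suc n = mkℚ (+ 1) n (1-coprimeTo (suc n))

fromℕ-suc*1/suc : ∀ n → fromℕ (suc n) * 1/suc n ≡ 1ℚ
fromℕ-suc*1/suc n rewrite fromℤ≡mkℚ (+ suc n) = ℚₚ.*-inverseʳ (mkℚ (+ suc n) 0 (Coprimality.sym (1-coprimeTo (suc n))))

pos⇒≢0 : ∀ p → Positive p → p ≢ 0ℚ
pos⇒≢0 p p>0 refl = ℚₚ.<-irrefl refl (ℚₚ.positive⁻¹ 0ℚ {{p>0}})

fromℕ-suc-positive : ∀ n → Positive (fromℕ (suc n))
fromℕ-suc-positive n rewrite fromℤ≡mkℚ (+ suc n) = _

infixl 6 _+ₚ_ _-ₚ_
infixr 7 _*ₚ_

_+ₚ_ : Poly → Poly → Poly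
[]      +ₚ q       = q
(a ∷ p) +ₚ []      = a ∷ p
(a ∷ p) +ₚ (b ∷ q) = (a + b) ∷ (p +ₚ q)

_*ₚ_ : ℚ → Poly → Poly
c *ₚ []      = []
c *ₚ (a ∷ p) = c * a ∷ c *ₚ p

_-ₚ_ : Poly → Poly → Poly
p -ₚ q = p +ₚ (- 1ℚ) *ₚ q

mulLinear : ℚ → ℚ → Poly → Poly
mulLinear α β p = α *ₚ p +ₚ (0ℚ ∷ β *ₚ p)

shiftₚ : ℕ → Poly → Poly
shiftₚ k []      = []
shiftₚ k (a ∷ p) = (a ∷ []) +ₚ mulLinear (- fromℕ k) 1ℚ (shiftₚ k p)

eval-+ₚ : ∀ p q t → eval (p +ₚ q) t ≡ eval p t + eval q t
eval-+ₚ []      q       t = sym (ℚₚ.+-identityˡ _)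
eval-+ₚ (a ∷ p) []      t = sym (ℚₚ.+-identityʳ _)
eval-+ₚ (a ∷ p) (b ∷ q) t rewrite eval-+ₚ p q t =
  solve 5 (λ a b x u v → (a :+ b) :+ x :* (u :+ v) := (a :+ x :* u) :+ (b :+ x :* v))
    refl a b (fromℤ t) (eval p t) (eval q t)

eval-*ₚ : ∀ c p t → eval (c *ₚ p) t ≡ c * eval p t
eval-*ₚ c []      t = sym (ℚₚ.*-zeroʳ c)
eval-*ₚ c (a ∷ p) t rewrite eval-*ₚ c p t =
  solve 4 (λ c a x u → c :* a :+ x :* (c :* u) := c :* (a :+ x :* u)) refl c a (fromℤ t) (eval p t)

eval--ₚ : ∀ p q t → eval (p -ₚ q) t ≡ eval p t - eval q t
eval--ₚ p q t rewrite eval-+ₚ p ((- 1ℚ) *ₚ q) t | eval-*ₚ (- 1ℚ) q t =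
  solve 2 (λ u v → u :+ (:- con 1ℚ) :* v := u :- v) refl (eval p t) (eval q t)

eval-mulLinear : ∀ α β p t → eval (mulLinear α β p) t ≡ (α + β * fromℤ t) * eval p t
eval-mulLinear α β p t rewrite eval-+ₚ (α *ₚ p) (0ℚ ∷ β *ₚ p) t | eval-*ₚ α p t | eval-*ₚ β p t =
  solve 4 (λ α β x u → α :* u :+ (con 0ℚ :+ x :* (β :* u)) := (α :+ β :* x) :* u) refl α β (fromℤ t) (eval p t)

eval-shiftₚ : ∀ k p t → eval (shiftₚ k p) t ≡ eval p (t ℤ.- + k)
eval-shiftₚ k []      t = refl
eval-shiftₚ k (a ∷ p) t
  rewrite eval-+ₚ (a ∷ []) (mulLinear (- fromℕ k) 1ℚ (shiftₚ k p)) t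
        | eval-mulLinear (- fromℕ k) 1ℚ (shiftₚ k p) t
        | eval-shiftₚ k p t
        | fromℤ-- t (+ k) =
  solve 4 (λ a x c u → (a :+ x :* con 0ℚ) :+ ((:- c) :+ con 1ℚ :* x) :* u := a :+ (x :- c) :* u)
    refl a (fromℤ t) (fromℕ k) (eval p (t ℤ.- + k))

coeff-+ₚ : ∀ p q i → coeff (p +ₚ q) i ≡ coeff p i + coeff q i
coeff-+ₚ []      q       i       = sym (ℚₚ.+-identityˡ _)
coeff-+ₚ (a ∷ p) []      zero    = sym (ℚₚ.+-identityʳ _)
coeff-+ₚ (a ∷ p) []      (suc i) = sym (ℚₚ.+-identityʳ _)
coeff-+ₚ (a ∷ p) (b ∷ q) zero    = refl
coeff-+ₚ (a ∷ p) (b ∷ q) (suc i) = coeff-+ₚ p q i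

coeff-*ₚ : ∀ c p i → coeff (c *ₚ p) i ≡ c * coeff p i
coeff-*ₚ c []      i       = sym (ℚₚ.*-zeroʳ c)
coeff-*ₚ c (a ∷ p) zero    = refl
coeff-*ₚ c (a ∷ p) (suc i) = coeff-*ₚ c p i

coeff-mulLinear-suc : ∀ α β p i → coeff (mulLinear α β p) (suc i) ≡ α * coeff p (suc i) + β * coeff p i
coeff-mulLinear-suc α β p i
  rewrite coeff-+ₚ (α *ₚ p) (0ℚ ∷ β *ₚ p) (suc i) | coeff-*ₚ α p (suc i) | coeff-*ₚ β p i = refl

DegreeBelow : Poly → ℕ → Set
DegreeBelow p d = ∀ i → d ≤ i → coeff p i ≡ 0ℚ

degreeBelow-length : ∀ p → DegreeBelow p (length p)
degreeBelow-length []      i       _         = refl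
degreeBelow-length (a ∷ p) (suc i) (s≤s le) = degreeBelow-length p i le

degreeBelow-weaken : ∀ p {d e} → d ≤ e → DegreeBelow p d → DegreeBelow p e
degreeBelow-weaken p d≤e p<d i e≤i = p<d i (ℕₚ.≤-trans d≤e e≤i)

degreeBelow-tail : ∀ a p {d} → DegreeBelow (a ∷ p) (suc d) → DegreeBelow p d
degreeBelow-tail a p ap<d i d≤i = ap<d (suc i) (s≤s d≤i)

degreeBelow-∷ : ∀ a p {d} → DegreeBelow p d → DegreeBelow (a ∷ p) (suc d)
degreeBelow-∷ a p p<d (suc i) (s≤s d≤i) = p<d i d≤i

eval-degreeBelow-0 : ∀ p → DegreeBelow p 0 → ∀ t → eval p t ≡ 0ℚ
eval-degreeBelow-0 []      _    t = refl
eval-degreeBelow-0 (a ∷ p) ap<0 t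
  rewrite ap<0 0 z≤n | eval-degreeBelow-0 p (λ i _ → ap<0 (suc i) z≤n) t =
  trans (ℚₚ.+-identityˡ (fromℤ t * 0ℚ)) (ℚₚ.*-zeroʳ (fromℤ t))

degreeBelow-+ₚ : ∀ p q {d} → DegreeBelow p d → DegreeBelow q d → DegreeBelow (p +ₚ q) d
degreeBelow-+ₚ p q p<d q<d i d≤i rewrite coeff-+ₚ p q i | p<d i d≤i | q<d i d≤i = refl

degreeBelow-*ₚ : ∀ c p {d} → DegreeBelow p d → DegreeBelow (c *ₚ p) d
degreeBelow-*ₚ c p p<d i d≤i rewrite coeff-*ₚ c p i | p<d i d≤i = ℚₚ.*-zeroʳ c

degreeBelow--ₚ : ∀ p q {d} → DegreeBelow p d → DegreeBelow q d → DegreeBelow (p -ₚ q) d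
degreeBelow--ₚ p q p<d q<d = degreeBelow-+ₚ p ((- 1ℚ) *ₚ q) p<d (degreeBelow-*ₚ (- 1ℚ) q q<d)

degreeBelow-mulLinear : ∀ α β p {d} → DegreeBelow p d → DegreeBelow (mulLinear α β p) (suc d)
degreeBelow-mulLinear α β p p<d = degreeBelow-+ₚ (α *ₚ p) (0ℚ ∷ β *ₚ p)
  (degreeBelow-weaken (α *ₚ p) (ℕₚ.n≤1+n _) (degreeBelow-*ₚ α p p<d)) (degreeBelow-∷ 0ℚ (β *ₚ p) (degreeBelow-*ₚ β p p<d))

degreeBelow-mulLinear-0 : ∀ α β p → DegreeBelow p 0 → DegreeBelow (mulLinear α β p) 0
degreeBelow-mulLinear-0 α β p p<0 zero _
  rewrite coeff-+ₚ (α *ₚ p) (0ℚ ∷ β *ₚ p) 0 | coeff-*ₚ α p 0 | p<0 0 z≤n =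
  solve 1 (λ α → α :* con 0ℚ :+ con 0ℚ := con 0ℚ) refl α
degreeBelow-mulLinear-0 α β p p<0 (suc i) _
  rewrite coeff-mulLinear-suc α β p i | p<0 i z≤n | p<0 (suc i) z≤n =
  solve 2 (λ α β → α :* con 0ℚ :+ β :* con 0ℚ := con 0ℚ) refl α β

degreeBelow-shiftₚ : ∀ k p {d} → DegreeBelow p d → DegreeBelow (shiftₚ k p) d
degreeBelow-shiftₚ k []      _ = λ _ _ → refl
degreeBelow-shiftₚ k (a ∷ p) {zero} ap<0 rewrite ap<0 0 z≤n =
  degreeBelow-+ₚ (0ℚ ∷ []) (mulLinear (- fromℕ k) 1ℚ (shiftₚ k p)) (λ { zero _ → refl ; (suc _) _ → refl })
    (degreeBelow-mulLinear-0 (- fromℕ k) 1ℚ (shiftₚ k p) (degreeBelow-shiftₚ k p (λ i _ → ap<0 (suc i) z≤n)))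
degreeBelow-shiftₚ k (a ∷ p) {suc d} ap<d =
  degreeBelow-+ₚ (a ∷ []) (mulLinear (- fromℕ k) 1ℚ (shiftₚ k p)) (degreeBelow-weaken (a ∷ []) (s≤s z≤n) (degreeBelow-length (a ∷ [])))
    (degreeBelow-mulLinear (- fromℕ k) 1ℚ (shiftₚ k p) (degreeBelow-shiftₚ k p (degreeBelow-tail a p ap<d)))

coeff-shiftₚ-∷ : ∀ k a p i → coeff (shiftₚ k (a ∷ p)) i
  ≡ coeff (a ∷ []) i + (- fromℕ k * coeff (shiftₚ k p) i + coeff (0ℚ ∷ 1ℚ *ₚ shiftₚ k p) i)
coeff-shiftₚ-∷ k a p i
  rewrite coeff-+ₚ (a ∷ []) (mulLinear (- fromℕ k) 1ℚ (shiftₚ k p)) i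
        | coeff-+ₚ (- fromℕ k *ₚ shiftₚ k p) (0ℚ ∷ 1ℚ *ₚ shiftₚ k p) i
        | coeff-*ₚ (- fromℕ k) (shiftₚ k p) i = refl

coeff-shiftₚ-leading : ∀ k p d → DegreeBelow p (suc d) → coeff (shiftₚ k p) d ≡ coeff p d
coeff-shiftₚ-leading k []      d       _    = refl
coeff-shiftₚ-leading k (a ∷ p) zero    ap<1
  rewrite coeff-shiftₚ-∷ k a p 0 | degreeBelow-shiftₚ k p (degreeBelow-tail a p ap<1) 0 z≤n =
  solve 2 (λ a c → a :+ (c :* con 0ℚ :+ con 0ℚ) := a) refl a (- fromℕ k)
coeff-shiftₚ-leading k (a ∷ p) (suc d) ap<d
  rewrite coeff-shiftₚ-∷ k a p (suc d) | coeff-*ₚ 1ℚ (shiftₚ k p) d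
        | degreeBelow-shiftₚ k p (degreeBelow-tail a p ap<d) (suc d) ℕₚ.≤-refl
        | coeff-shiftₚ-leading k p d (degreeBelow-tail a p ap<d) =
  solve 2 (λ c u → con 0ℚ :+ (c :* con 0ℚ :+ con 1ℚ :* u) := u) refl (- fromℕ k) (coeff p d)

coeff-shiftₚ-subleading : ∀ k p d → DegreeBelow p (suc (suc d)) →
  coeff (shiftₚ k p) d ≡ coeff p d - fromℕ (suc d) * fromℕ k * coeff p (suc d)
coeff-shiftₚ-subleading k []      d       _ =
  solve 2 (λ a b → con 0ℚ := con 0ℚ :- a :* b :* con 0ℚ) refl (fromℕ (suc d)) (fromℕ k)
coeff-shiftₚ-subleading k (a ∷ p) zero    ap<2
  rewrite coeff-shiftₚ-∷ k a p 0 | coeff-shiftₚ-leading k p 0 (degreeBelow-tail a p ap<2) =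
  solve 3 (λ a k c → a :+ ((:- k) :* c :+ con 0ℚ) := a :- con 1ℚ :* k :* c) refl a (fromℕ k) (coeff p 0)
coeff-shiftₚ-subleading k (a ∷ p) (suc d) ap<d
  rewrite coeff-shiftₚ-∷ k a p (suc d) | coeff-*ₚ 1ℚ (shiftₚ k p) d
        | coeff-shiftₚ-leading k p (suc d) (degreeBelow-tail a p ap<d)
        | coeff-shiftₚ-subleading k p d (degreeBelow-tail a p ap<d)
        | fromℕ-+ 1 (suc d) =
  solve 4 (λ k c₁ c₀ d₁ → con 0ℚ :+ ((:- k) :* c₁ :+ con 1ℚ :* (c₀ :- d₁ :* k :* c₁)) := c₀ :- (con 1ℚ :+ d₁) :* k :* c₁)
    refl (fromℕ k) (coeff p (suc d)) (coeff p d) (fromℕ (suc d))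

degreeBelow-sub-shiftₚ : ∀ k p d → DegreeBelow p (suc d) → DegreeBelow (p -ₚ shiftₚ k p) d
degreeBelow-sub-shiftₚ k p d p<d i d≤i with ℕₚ.m≤n⇒m<n∨m≡n d≤i
... | inj₁ d<i = degreeBelow--ₚ p (shiftₚ k p) p<d (degreeBelow-shiftₚ k p p<d) i d<i
... | inj₂ refl
  rewrite coeff-+ₚ p ((- 1ℚ) *ₚ shiftₚ k p) d | coeff-*ₚ (- 1ℚ) (shiftₚ k p) d | coeff-shiftₚ-leading k p d p<d =
  solve 1 (λ u → u :+ (:- con 1ℚ) :* u := con 0ℚ) refl (coeff p d)

Δ : ℕ → (ℤ → ℚ) → ℤ → ℚ
Δ c f t = f t - f (t ℤ.- + c)

Δs : List ℕ → (ℤ → ℚ) → ℤ → ℚ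
Δs []       f = f
Δs (c ∷ cs) f = Δs cs (Δ c f)

Δs-cong : ∀ cs {f g} → (∀ t → f t ≡ g t) → ∀ t → Δs cs f t ≡ Δs cs g t
Δs-cong []       f≗g = f≗g
Δs-cong (c ∷ cs) f≗g = Δs-cong cs (λ t → cong₂ _-_ (f≗g t) (f≗g (t ℤ.- + c)))

Δs-+ : ∀ cs f g t → Δs cs (λ s → f s + g s) t ≡ Δs cs f t + Δs cs g t
Δs-+ []       f g t = refl
Δs-+ (c ∷ cs) f g t = trans
  (Δs-cong cs (λ s → solve 4 (λ a b a′ b′ → (a :+ b) :- (a′ :+ b′) := (a :- a′) :+ (b :- b′))
                        refl (f s) (g s) (f (s ℤ.- + c)) (g (s ℤ.- + c))) t)
  (Δs-+ cs (Δ c f) (Δ c g) t)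

Δs-- : ∀ cs f g t → Δs cs (λ s → f s - g s) t ≡ Δs cs f t - Δs cs g t
Δs-- []       f g t = refl
Δs-- (c ∷ cs) f g t = trans
  (Δs-cong cs (λ s → solve 4 (λ a b a′ b′ → (a :- b) :- (a′ :- b′) := (a :- a′) :- (b :- b′))
                        refl (f s) (g s) (f (s ℤ.- + c)) (g (s ℤ.- + c))) t)
  (Δs-- cs (Δ c f) (Δ c g) t)

Δs-0 : ∀ cs t → Δs cs (λ _ → 0ℚ) t ≡ 0ℚ
Δs-0 []       t = refl
Δs-0 (c ∷ cs) t = Δs-0 cs t

Δs-sum : ∀ {A : Set} cs (F : A → ℤ → ℚ) xs t →
  Δs cs (λ s → sumℚ (map (λ x → F x s) xs)) t ≡ sumℚ (map (λ x → Δs cs (F x) t) xs)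
Δs-sum cs F []       t = Δs-0 cs t
Δs-sum cs F (x ∷ xs) t = trans (Δs-+ cs (F x) (λ s → sumℚ (map (λ x → F x s) xs)) t)
  (cong (_+_ (Δs cs (F x) t)) (Δs-sum cs F xs t))

Δ-comm : ∀ c c′ f t → Δ c (Δ c′ f) t ≡ Δ c′ (Δ c f) t
Δ-comm c c′ f t rewrite ℤ-Comm.xy∙z≈xz∙y t (ℤ.- + c) (ℤ.- + c′) =
  solve 4 (λ a b a′ b′ → (a :- b) :- (a′ :- b′) := (a :- a′) :- (b :- b′))
    refl (f t) (f (t ℤ.- + c′)) (f (t ℤ.- + c)) (f (t ℤ.- + c′ ℤ.- + c))

Δs-Δ : ∀ cs c f t → Δs cs (Δ c f) t ≡ Δ c (Δs cs f) t
Δs-Δ []        c f t = refl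
Δs-Δ (c′ ∷ cs) c f t = begin
  Δs cs (Δ c′ (Δ c f)) t ≡⟨ Δs-cong cs (Δ-comm c′ c f) t ⟩
  Δs cs (Δ c (Δ c′ f)) t ≡⟨ Δs-Δ cs c (Δ c′ f) t ⟩
  Δ c (Δs cs (Δ c′ f)) t ∎
  where open ≡-Reasoning

-[1+]%ℕ : ∀ m k .{{_ : NonZero k}} → -[1+ m ] %ℕ k ≡ (k ℕ.∸ suc m ℕ.% k) ℕ.% k
-[1+]%ℕ m k@(suc k′) with suc m ℕ.% k
... | zero  = sym (DivMod.n%n≡0 k)
... | suc s = sym (DivMod.m<n⇒m%n≡m (s≤s (ℕₚ.m∸n≤m k′ s)))

∸-%-complement : ∀ k .{{_ : NonZero k}} r → r < k → (k ℕ.∸ (k ℕ.∸ r) ℕ.% k) ℕ.% k ≡ r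
∸-%-complement k zero    _   = trans (cong (λ x → (k ℕ.∸ x) ℕ.% k) (DivMod.n%n≡0 k)) (DivMod.n%n≡0 k)
∸-%-complement k (suc r) r<k = begin
  (k ℕ.∸ (k ℕ.∸ suc r) ℕ.% k) ℕ.% k ≡⟨ cong (λ x → (k ℕ.∸ x) ℕ.% k) (DivMod.m<n⇒m%n≡m (ℕₚ.∸-monoʳ-< {k} {suc r} {0} (s≤s z≤n) (ℕₚ.<⇒≤ r<k))) ⟩
  (k ℕ.∸ (k ℕ.∸ suc r)) ℕ.% k       ≡⟨ cong (ℕ._% k) (ℕₚ.m∸[m∸n]≡n (ℕₚ.<⇒≤ r<k)) ⟩
  suc r ℕ.% k                       ≡⟨ DivMod.m<n⇒m%n≡m r<k ⟩
  suc r                             ∎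
  where open ≡-Reasoning

%ℕ-unique : ∀ k .{{_ : NonZero k}} r q → r < k → (+ r ℤ.+ + k ℤ.* q) %ℕ k ≡ r
%ℕ-unique k r (+ n) r<k = begin
  (+ r ℤ.+ + k ℤ.* + n) %ℕ k ≡⟨ cong (λ x → (+ r ℤ.+ x) %ℕ k) (trans (ℤₚ.*-comm (+ k) (+ n)) (sym (ℤₚ.pos-* n k))) ⟩
  (+ r ℤ.+ + (n ℕ.* k)) %ℕ k ≡⟨ cong (_%ℕ k) (sym (ℤₚ.pos-+ r (n ℕ.* k))) ⟩
  (r ℕ.+ n ℕ.* k) ℕ.% k      ≡⟨ DivMod.[m+kn]%n≡m%n r n k ⟩
  r ℕ.% k                    ≡⟨ DivMod.m<n⇒m%n≡m r<k ⟩
  r                          ∎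
  where open ≡-Reasoning
%ℕ-unique k r -[1+ n ] r<k = begin
  (+ r ℤ.+ + k ℤ.* -[1+ n ]) %ℕ k    ≡⟨ cong (_%ℕ k) negative ⟩
  -[1+ K ℕ.∸ suc r ] %ℕ k             ≡⟨ -[1+]%ℕ (K ℕ.∸ suc r) k ⟩
  (k ℕ.∸ suc (K ℕ.∸ suc r) ℕ.% k) ℕ.% k ≡⟨ cong (λ x → (k ℕ.∸ x ℕ.% k) ℕ.% k) (sym K∸r) ⟩
  (k ℕ.∸ (K ℕ.∸ r) ℕ.% k) ℕ.% k       ≡⟨ cong (λ x → (k ℕ.∸ x ℕ.% k) ℕ.% k) K∸r≡k∸r+nk ⟩
  (k ℕ.∸ ((k ℕ.∸ r) ℕ.+ n ℕ.* k) ℕ.% k) ℕ.% k ≡⟨ cong (λ x → (k ℕ.∸ x) ℕ.% k) (DivMod.[m+kn]%n≡m%n (k ℕ.∸ r) n k) ⟩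
  (k ℕ.∸ (k ℕ.∸ r) ℕ.% k) ℕ.% k       ≡⟨ ∸-%-complement k r r<k ⟩
  r                                   ∎
  where
  open ≡-Reasoning
  K = k ℕ.* suc n
  r<K : r < K
  r<K = ℕₚ.<-≤-trans r<k (ℕₚ.m≤m*n k (suc n))
  K∸r : K ℕ.∸ r ≡ suc (K ℕ.∸ suc r)
  K∸r = ℕₚ.+-∸-assoc 1 r<K
  K∸r≡k∸r+nk : K ℕ.∸ r ≡ (k ℕ.∸ r) ℕ.+ n ℕ.* k
  K∸r≡k∸r+nk = trans (cong (ℕ._∸ r) (ℕₚ.*-suc k n))
    (trans (ℕₚ.+-∸-comm (k ℕ.* n) (ℕₚ.<⇒≤ r<k)) (cong (λ x → (k ℕ.∸ r) ℕ.+ x) (ℕₚ.*-comm k n)))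
  negative : + r ℤ.+ + k ℤ.* -[1+ n ] ≡ -[1+ K ℕ.∸ suc r ]
  negative = begin
    + r ℤ.+ + k ℤ.* -[1+ n ]        ≡⟨ cong (λ x → + r ℤ.+ x) (sym (ℤₚ.neg-distribʳ-* (+ k) (+ suc n))) ⟩
    + r ℤ.+ ℤ.- (+ k ℤ.* + suc n)   ≡⟨ cong (λ x → + r ℤ.+ ℤ.- x) (sym (ℤₚ.pos-* k (suc n))) ⟩
    + r ℤ.- + K                     ≡⟨ ℤₚ.m-n≡m⊖n r K ⟩
    r ℤ.⊖ K                         ≡⟨ ℤₚ.⊖-< r<K ⟩
    ℤ.- + (K ℕ.∸ r)                 ≡⟨ cong (λ x → ℤ.- + x) K∸r ⟩
    -[1+ K ℕ.∸ suc r ]              ∎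

%ℕ-periodic : ∀ k .{{_ : NonZero k}} t q → (t ℤ.+ + k ℤ.* q) %ℕ k ≡ t %ℕ k
%ℕ-periodic k t q = begin
  (t ℤ.+ + k ℤ.* q) %ℕ k                            ≡⟨ cong (λ s → (s ℤ.+ + k ℤ.* q) %ℕ k) (a≡a%ℕn+[a/ℕn]*n t k) ⟩
  (+ r ℤ.+ d ℤ.* + k ℤ.+ + k ℤ.* q) %ℕ k            ≡⟨ cong (_%ℕ k) regroup ⟩
  (+ r ℤ.+ + k ℤ.* (d ℤ.+ q)) %ℕ k                  ≡⟨ %ℕ-unique k r (d ℤ.+ q) (n%ℕd<d t k) ⟩
  r                                                 ∎
  where
  open ≡-Reasoning
  r = t %ℕ k
  d = t /ℕ k
  regroup : + r ℤ.+ d ℤ.* + k ℤ.+ + k ℤ.* q ≡ + r ℤ.+ + k ℤ.* (d ℤ.+ q)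
  regroup = trans (ℤₚ.+-assoc (+ r) (d ℤ.* + k) (+ k ℤ.* q))
    (cong (λ x → + r ℤ.+ x) (trans (cong (ℤ._+ + k ℤ.* q) (ℤₚ.*-comm d (+ k))) (sym (ℤₚ.*-distribˡ-+ (+ k) d q))))

residue : ∀ k .{{_ : NonZero k}} → ℤ → Fin k
residue k t = Fin.fromℕ< (n%ℕd<d t k)

residue-periodic : ∀ k .{{_ : NonZero k}} t q → residue k (t ℤ.+ + k ℤ.* q) ≡ residue k t
residue-periodic k t q = Finₚ.toℕ-injective
  (trans (Finₚ.toℕ-fromℕ< _) (trans (%ℕ-periodic k t q) (sym (Finₚ.toℕ-fromℕ< _))))

residue-toℕ : ∀ k .{{_ : NonZero k}} (j : Fin k) → residue k (+ toℕ j) ≡ j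
residue-toℕ k j = Finₚ.toℕ-injective (trans (Finₚ.toℕ-fromℕ< _) (DivMod.m<n⇒m%n≡m (Finₚ.toℕ<n j)))

residue-sub : ∀ k .{{_ : NonZero k}} t c → residue k (t ℤ.- + c) ≡ residue k (+ toℕ (residue k t) ℤ.- + c)
residue-sub k t c = begin
  residue k (t ℤ.- + c)                                  ≡⟨ cong (λ s → residue k (s ℤ.- + c)) (a≡a%ℕn+[a/ℕn]*n t k) ⟩
  residue k (+ (t %ℕ k) ℤ.+ (t /ℕ k) ℤ.* + k ℤ.- + c)      ≡⟨ cong (residue k) regroup ⟩
  residue k ((+ (t %ℕ k) ℤ.- + c) ℤ.+ + k ℤ.* (t /ℕ k))    ≡⟨ residue-periodic k (+ (t %ℕ k) ℤ.- + c) (t /ℕ k) ⟩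
  residue k (+ (t %ℕ k) ℤ.- + c)                         ≡⟨ cong (λ r → residue k (+ r ℤ.- + c)) (sym (Finₚ.toℕ-fromℕ< _)) ⟩
  residue k (+ toℕ (residue k t) ℤ.- + c)                ∎
  where
  open ≡-Reasoning
  regroup : + (t %ℕ k) ℤ.+ (t /ℕ k) ℤ.* + k ℤ.- + c ≡ (+ (t %ℕ k) ℤ.- + c) ℤ.+ + k ℤ.* (t /ℕ k)
  regroup = trans (ℤ-Comm.xy∙z≈xz∙y (+ (t %ℕ k)) ((t /ℕ k) ℤ.* + k) (ℤ.- + c)) (cong (λ x → (+ (t %ℕ k) ℤ.- + c) ℤ.+ x) (ℤₚ.*-comm (t /ℕ k) (+ k)))

residue-sub-divisible : ∀ k .{{_ : NonZero k}} c → k ∣ c → (j : Fin k) → residue k (+ toℕ j ℤ.- + c) ≡ j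
residue-sub-divisible k c (divides d refl) j = begin
  residue k (+ toℕ j ℤ.- + (d ℕ.* k))        ≡⟨ cong (λ x → residue k (+ toℕ j ℤ.+ x)) -dk≡k*-d ⟩
  residue k (+ toℕ j ℤ.+ + k ℤ.* ℤ.- + d)    ≡⟨ residue-periodic k (+ toℕ j) (ℤ.- + d) ⟩
  residue k (+ toℕ j)                        ≡⟨ residue-toℕ k j ⟩
  j                                          ∎
  where
  open ≡-Reasoning
  -dk≡k*-d : ℤ.- + (d ℕ.* k) ≡ + k ℤ.* ℤ.- + d
  -dk≡k*-d = trans (cong ℤ.-_ (trans (ℤₚ.pos-* d k) (ℤₚ.*-comm (+ d) (+ k)))) (ℤₚ.neg-distribʳ-* (+ k) (+ d))

-- At period 0 (where no residue exists) the value is junk.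
quasiPoly : (k : ℕ) → (Fin k → Poly) → ℤ → ℚ
quasiPoly zero      h t = 0ℚ
quasiPoly k@(suc _) h t = eval (h (residue k t)) t

quasiPoly-constituents : ∀ k .{{_ : NonZero k}} h → IsConstituents (quasiPoly k h) k h
quasiPoly-constituents k@(suc _) h j m =
  cong (λ i → eval (h i) (+ toℕ j ℤ.+ + k ℤ.* m)) (trans (residue-periodic k (+ toℕ j) m) (residue-toℕ k j))

quasiPoly-degree : ∀ k .{{_ : NonZero k}} h d → (∀ j → DegreeBelow (h j) (suc d)) → ∃[ j ] coeff (h j) d ≢ 0ℚ →
  QuasiPoly (quasiPoly k h) k d
quasiPoly-degree k h d h<d top = ℕ.>-nonZero⁻¹ k , h , quasiPoly-constituents k h , h<d , top

quasiPoly-degreeBelow-0 : ∀ k .{{_ : NonZero k}} h → (∀ j → DegreeBelow (h j) 0) → ∀ t → quasiPoly k h t ≡ 0ℚ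
quasiPoly-degreeBelow-0 k@(suc _) h h<0 t = eval-degreeBelow-0 (h (residue k t)) (h<0 _) t

Δᶜ : ∀ k .{{_ : NonZero k}} → ℕ → (Fin k → Poly) → Fin k → Poly
Δᶜ k c h j = h j -ₚ shiftₚ c (h (residue k (+ toℕ j ℤ.- + c)))

Δ-quasiPoly : ∀ k .{{_ : NonZero k}} c h t → Δ c (quasiPoly k h) t ≡ quasiPoly k (Δᶜ k c h) t
Δ-quasiPoly k@(suc _) c h t = sym (begin
  eval (h r -ₚ shiftₚ c (h r′)) t                     ≡⟨ eval--ₚ (h r) (shiftₚ c (h r′)) t ⟩
  eval (h r) t - eval (shiftₚ c (h r′)) t             ≡⟨ cong (λ x → eval (h r) t - x) (eval-shiftₚ c (h r′) t) ⟩
  eval (h r) t - eval (h r′) (t ℤ.- + c)              ≡⟨ cong (λ i → eval (h r) t - eval (h i) (t ℤ.- + c)) (sym (residue-sub k t c)) ⟩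
  eval (h r) t - eval (h (residue k (t ℤ.- + c))) (t ℤ.- + c) ∎)
  where
  open ≡-Reasoning
  r = residue k t
  r′ = residue k (+ toℕ r ℤ.- + c)

degreeBelow-Δᶜ : ∀ k .{{_ : NonZero k}} c h {d} → (∀ j → DegreeBelow (h j) d) → ∀ j → DegreeBelow (Δᶜ k c h j) d
degreeBelow-Δᶜ k c h h<d j = degreeBelow--ₚ (h j) (shiftₚ c (h j′)) (h<d j) (degreeBelow-shiftₚ c (h j′) (h<d j′))
  where j′ = residue k (+ toℕ j ℤ.- + c)

degreeBelow-Δᶜ-∣ : ∀ k .{{_ : NonZero k}} c h {d} → k ∣ c →
  (∀ j → DegreeBelow (h j) (suc d)) → ∀ j → DegreeBelow (Δᶜ k c h j) d
degreeBelow-Δᶜ-∣ k c h {d} k∣c h<d j rewrite residue-sub-divisible k c k∣c j = degreeBelow-sub-shiftₚ c (h j) d (h<d j)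

countDivisible : ℕ → List ℕ → ℕ
countDivisible k cs = length (filter (k ∣?_) cs)

-- Δ c maps constituents to constituents, lowering every degree when k ∣ c.
Δs-quasiPoly-vanishes : ∀ k .{{_ : NonZero k}} cs h d → (∀ j → DegreeBelow (h j) d) →
  d ≤ countDivisible k cs → ∀ t → Δs cs (quasiPoly k h) t ≡ 0ℚ
Δs-quasiPoly-vanishes k []       h zero h<d _ t = quasiPoly-degreeBelow-0 k h h<d t
Δs-quasiPoly-vanishes k (c ∷ cs) h d h<d d≤ t with k ∣? c
... | yes k∣c = trans (Δs-cong cs (Δ-quasiPoly k c h) t) (dropDegree d h<d d≤)
  where
  dropDegree : ∀ d → (∀ j → DegreeBelow (h j) d) → d ≤ suc (countDivisible k cs) →
    Δs cs (quasiPoly k (Δᶜ k c h)) t ≡ 0ℚ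
  dropDegree zero    h<0 _         = Δs-quasiPoly-vanishes k cs (Δᶜ k c h) 0 (degreeBelow-Δᶜ k c h h<0) z≤n t
  dropDegree (suc d) h<d (s≤s d≤) = Δs-quasiPoly-vanishes k cs (Δᶜ k c h) d (degreeBelow-Δᶜ-∣ k c h k∣c h<d) d≤ t
... | no _ = trans (Δs-cong cs (Δ-quasiPoly k c h) t)
  (Δs-quasiPoly-vanishes k cs (Δᶜ k c h) d (degreeBelow-Δᶜ k c h h<d) d≤ t)

-- Lattice points in dilated simplices

when : ∀ {P : Set} → Dec P → ℕ → ℕ
when (yes _) x = x
when (no _)  _ = 0

when-cong : ∀ {P Q : Set} (p? : Dec P) (q? : Dec Q) → (P → Q) → (Q → P) → ∀ {x y} → x ≡ y → when p? x ≡ when q? y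
when-cong (yes _) (yes _) _   _   x≡y = x≡y
when-cong (yes p) (no ¬q) p→q _   _   = contradiction (p→q p) ¬q
when-cong (no ¬p) (yes q) _   q→p _   = contradiction (q→p q) ¬p
when-cong (no _)  (no _)  _   _   _   = refl

when-no : ∀ {P : Set} (p? : Dec P) → ¬ P → ∀ {x} → when p? x ≡ 0
when-no (yes p) ¬p = contradiction p ¬p
when-no (no _)  _  = refl

sumBelow : (ℕ → ℕ) → ℕ → ℕ
sumBelow g zero    = 0
sumBelow g (suc n) = g 0 ℕ.+ sumBelow (g ∘ suc) n

sumBelow-cong : ∀ {g h} n → (∀ m → g m ≡ h m) → sumBelow g n ≡ sumBelow h n
sumBelow-cong zero    g≗h = refl
sumBelow-cong (suc n) g≗h = cong₂ ℕ._+_ (g≗h 0) (sumBelow-cong n (g≗h ∘ suc))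

sumBelow-vanishing : ∀ g n k → (∀ m → n ≤ m → g m ≡ 0) → sumBelow g (n ℕ.+ k) ≡ sumBelow g n
sumBelow-vanishing g zero    zero    _    = refl
sumBelow-vanishing g zero    (suc k) g≡0 = cong₂ ℕ._+_ (g≡0 0 z≤n) (sumBelow-vanishing (g ∘ suc) 0 k (λ m _ → g≡0 (suc m) z≤n))
sumBelow-vanishing g (suc n) k       g≡0 = cong (g 0 ℕ.+_) (sumBelow-vanishing (g ∘ suc) n k (λ m n≤m → g≡0 (suc m) (s≤s n≤m)))

sum-map-applyUpTo : ∀ (g f : ℕ → ℕ) n → sum (map g (applyUpTo f n)) ≡ sumBelow (g ∘ f) n
sum-map-applyUpTo g f zero    = refl
sum-map-applyUpTo g f (suc n) = cong (g (f 0) ℕ.+_) (sum-map-applyUpTo g (f ∘ suc) n)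

module _ {A : Set} {P : A → Set} (P? : Decidable P) where

  length-filter-concat : ∀ xss → length (filter P? (concat xss)) ≡ sum (map (length ∘ filter P?) xss)
  length-filter-concat []         = refl
  length-filter-concat (xs ∷ xss) = begin
    length (filter P? (xs ++ concat xss))                   ≡⟨ cong length (Listₚ.filter-++ P? xs (concat xss)) ⟩
    length (filter P? xs ++ filter P? (concat xss))         ≡⟨ Listₚ.length-++ (filter P? xs) ⟩
    length (filter P? xs) ℕ.+ length (filter P? (concat xss)) ≡⟨ cong (length (filter P? xs) ℕ.+_) (length-filter-concat xss) ⟩
    length (filter P? xs) ℕ.+ sum (map (length ∘ filter P?) xss) ∎
    where open ≡-Reasoning

  length-filter-map : ∀ {B : Set} (f : B → A) xs → length (filter P? (map f xs)) ≡ length (filter (P? ∘ f) xs)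
  length-filter-map f []       = refl
  length-filter-map f (x ∷ xs) with P? (f x)
  ... | yes _ = cong suc (length-filter-map f xs)
  ... | no _  = length-filter-map f xs

length-filter-cong : ∀ {A : Set} {P Q : A → Set} (P? : Decidable P) (Q? : Decidable Q) →
  (∀ {x} → P x → Q x) → (∀ {x} → Q x → P x) → ∀ xs → length (filter P? xs) ≡ length (filter Q? xs)
length-filter-cong P? Q? P→Q Q→P []       = refl
length-filter-cong P? Q? P→Q Q→P (x ∷ xs) with P? x | Q? x
... | yes _  | yes _  = cong suc (length-filter-cong P? Q? P→Q Q→P xs)
... | yes p  | no ¬q  = contradiction (P→Q p) ¬q
... | no ¬p  | yes q  = contradiction (Q→P q) ¬p
... | no _   | no _   = length-filter-cong P? Q? P→Q Q→P xs

length-filter-none : ∀ {A : Set} {P : A → Set} (P? : Decidable P) → (∀ {x} → ¬ P x) → ∀ xs → length (filter P? xs) ≡ 0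
length-filter-none P? ¬P xs = cong length (Listₚ.filter-none P? (ListAll.universal (λ _ → ¬P) xs))

simplexCount : ∀ {ℓ} → Vec ℕ ℓ → ℕ → ℕ
simplexCount []       r = 1
simplexCount (c ∷ cs) r = sumBelow (λ m → when (c ℕ.* m ≤? r) (simplexCount cs (r ℕ.∸ c ℕ.* m))) (suc r)

count-box-∷ : ∀ {ℓ} (cs : Vec ℕ ℓ) a r ys →
  length (filter (λ n → a ℕ.+ dot cs n ≤? r) ys) ≡ when (a ≤? r) (length (filter (λ n → dot cs n ≤? r ℕ.∸ a) ys))
count-box-∷ cs a r ys with a ≤? r
... | yes a≤r = length-filter-cong _ _
  (λ h → ℕₚ.≤-trans (ℕₚ.≤-reflexive (sym (ℕₚ.m+n∸m≡n a _))) (ℕₚ.∸-monoˡ-≤ a h))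
  (λ h → ℕₚ.≤-trans (ℕₚ.+-monoʳ-≤ a h) (ℕₚ.≤-reflexive (ℕₚ.m+[n∸m]≡n a≤r))) ys
... | no a≰r  = length-filter-none _ (λ h → a≰r (ℕₚ.≤-trans (ℕₚ.m≤m+n a _) h)) ys

simplexCount-box : ∀ {ℓ} (cs : Vec ℕ ℓ) → VecAll.All (1 ≤_) cs → ∀ b r → r ≤ b →
  length (filter (λ n → dot cs n ≤? r) (box ℓ b)) ≡ simplexCount cs r
simplexCount-box []       _           b r r≤b = refl
simplexCount-box {suc ℓ} (c ∷ cs) (1≤c ∷ 1≤cs) b r r≤b = begin
  length (filter P? (concat (map (λ m → map (m ∷_) (box ℓ b)) (upTo (suc b)))))
    ≡⟨ length-filter-concat P? (map (λ m → map (m ∷_) (box ℓ b)) (upTo (suc b))) ⟩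
  sum (map (length ∘ filter P?) (map (λ m → map (m ∷_) (box ℓ b)) (upTo (suc b))))
    ≡⟨ cong sum (sym (Listₚ.map-∘ (upTo (suc b)))) ⟩
  sum (map (λ m → length (filter P? (map (m ∷_) (box ℓ b)))) (upTo (suc b)))
    ≡⟨ sum-map-applyUpTo (λ m → length (filter P? (map (m ∷_) (box ℓ b)))) (λ m → m) (suc b) ⟩
  sumBelow (λ m → length (filter P? (map (m ∷_) (box ℓ b)))) (suc b)
    ≡⟨ sumBelow-cong (suc b) (λ m → trans (length-filter-map P? (m ∷_) (box ℓ b)) (count-box-∷ cs (c ℕ.* m) r (box ℓ b))) ⟩
  sumBelow (λ m → when (c ℕ.* m ≤? r) (length (filter (λ n → dot cs n ≤? r ℕ.∸ c ℕ.* m) (box ℓ b)))) (suc b)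
    ≡⟨ sumBelow-cong (suc b) (λ m → when-cong (c ℕ.* m ≤? r) (c ℕ.* m ≤? r) (λ h → h) (λ h → h)
         (simplexCount-box cs 1≤cs b (r ℕ.∸ c ℕ.* m) (ℕₚ.≤-trans (ℕₚ.m∸n≤m r (c ℕ.* m)) r≤b))) ⟩
  sumBelow g (suc b)
    ≡⟨ cong (sumBelow g) (sym (ℕₚ.m+[n∸m]≡n (s≤s r≤b))) ⟩
  sumBelow g (suc r ℕ.+ (suc b ℕ.∸ suc r))
    ≡⟨ sumBelow-vanishing g (suc r) (suc b ℕ.∸ suc r) (λ m r<m → when-no (c ℕ.* m ≤? r) (λ cm≤r → ℕₚ.<-irrefl refl
         (ℕₚ.<-≤-trans r<m (ℕₚ.≤-trans (ℕₚ.m≤n*m m c {{ℕ.>-nonZero 1≤c}}) cm≤r)))) ⟩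
  sumBelow g (suc r) ∎
  where
  open ≡-Reasoning
  P? = λ (n : Vec ℕ (suc ℓ)) → dot (c ∷ cs) n ≤? r
  g = λ m → when (c ℕ.* m ≤? r) (simplexCount cs (r ℕ.∸ c ℕ.* m))

∸<⇒<*suc : ∀ {c r m} → 1 ≤ c → c ≤ r → r ℕ.∸ c < m → r < c ℕ.* suc m
∸<⇒<*suc {c} {r} {m} 1≤c c≤r r∸c<m = begin-strict
  r                    ≡⟨ sym (ℕₚ.m+[n∸m]≡n c≤r) ⟩
  c ℕ.+ (r ℕ.∸ c)      <⟨ ℕₚ.+-monoʳ-< c r∸c<m ⟩
  c ℕ.+ m              ≤⟨ ℕₚ.+-monoʳ-≤ c (ℕₚ.m≤n*m m c {{ℕ.>-nonZero 1≤c}}) ⟩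
  c ℕ.+ c ℕ.* m        ≡⟨ ℕₚ.*-suc c m ⟨
  c ℕ.* suc m          ∎
  where open ℕₚ.≤-Reasoning

simplexCount-∷ : ∀ {ℓ} c (cs : Vec ℕ ℓ) r → 1 ≤ c →
  simplexCount (c ∷ cs) r ≡ simplexCount cs r ℕ.+ when (c ≤? r) (simplexCount (c ∷ cs) (r ℕ.∸ c))
simplexCount-∷ c cs r 1≤c = cong₂ ℕ._+_ first (rest (c ≤? r))
  where
  first : when (c ℕ.* 0 ≤? r) (simplexCount cs (r ℕ.∸ c ℕ.* 0)) ≡ simplexCount cs r
  first rewrite ℕₚ.*-zeroʳ c = refl
  g : ℕ → ℕ
  g m = when (c ℕ.* m ≤? r) (simplexCount cs (r ℕ.∸ c ℕ.* m))
  c+cm≡c*suc-m : ∀ m → c ℕ.+ c ℕ.* m ≡ c ℕ.* suc m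
  c+cm≡c*suc-m m = sym (ℕₚ.*-suc c m)
  rest : (c≤?r : Dec (c ≤ r)) → sumBelow (g ∘ suc) r ≡ when c≤?r (simplexCount (c ∷ cs) (r ℕ.∸ c))
  rest (no c≰r) = sumBelow-vanishing (g ∘ suc) 0 r (λ m _ → when-no (c ℕ.* suc m ≤? r)
    (λ h → c≰r (ℕₚ.≤-trans (ℕₚ.m≤m+n c (c ℕ.* m)) (subst (_≤ r) (sym (c+cm≡c*suc-m m)) h))))
  rest (yes c≤r) = begin
    sumBelow (g ∘ suc) r                                   ≡⟨ cong (sumBelow (g ∘ suc)) (sym (ℕₚ.m+[n∸m]≡n r∸c<r)) ⟩
    sumBelow (g ∘ suc) (suc (r ℕ.∸ c) ℕ.+ (r ℕ.∸ suc (r ℕ.∸ c))) ≡⟨ sumBelow-vanishing (g ∘ suc) (suc (r ℕ.∸ c)) _ beyond ⟩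
    sumBelow (g ∘ suc) (suc (r ℕ.∸ c))                     ≡⟨ sumBelow-cong (suc (r ℕ.∸ c)) shifted ⟩
    simplexCount (c ∷ cs) (r ℕ.∸ c)                        ∎
    where
    open ≡-Reasoning
    r∸c<r : r ℕ.∸ c < r
    r∸c<r = ℕₚ.∸-monoʳ-< {r} {c} {0} 1≤c c≤r
    beyond : ∀ m → suc (r ℕ.∸ c) ≤ m → g (suc m) ≡ 0
    beyond m r∸c<m = when-no (c ℕ.* suc m ≤? r) (λ h → ℕₚ.<-irrefl refl (ℕₚ.<-≤-trans (∸<⇒<*suc 1≤c c≤r r∸c<m) h))
    shifted : ∀ m → g (suc m) ≡ when (c ℕ.* m ≤? r ℕ.∸ c) (simplexCount cs (r ℕ.∸ c ℕ.∸ c ℕ.* m))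
    shifted m = when-cong (c ℕ.* suc m ≤? r) (c ℕ.* m ≤? r ℕ.∸ c)
      (λ h → subst (_≤ r ℕ.∸ c) (ℕₚ.m+n∸m≡n c (c ℕ.* m)) (ℕₚ.∸-monoˡ-≤ c (subst (_≤ r) (sym (c+cm≡c*suc-m m)) h)))
      (λ h → subst (_≤ r) (c+cm≡c*suc-m m) (subst (c ℕ.+ c ℕ.* m ≤_) (ℕₚ.m+[n∸m]≡n c≤r) (ℕₚ.+-monoʳ-≤ c h)))
      (cong (simplexCount cs) (trans (cong (r ℕ.∸_) (sym (c+cm≡c*suc-m m))) (sym (ℕₚ.∸-+-assoc r c (c ℕ.* m)))))

w+m+n≡w+[m+n] : ∀ w m n → w ℤ.+ + m ℤ.+ + n ≡ w ℤ.+ + (m ℕ.+ n)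
w+m+n≡w+[m+n] w m n = trans (ℤₚ.+-assoc w (+ m) (+ n)) (cong (ℤ._+_ w) (sym (ℤₚ.pos-+ m n)))

w+[m+n]-m≡w+n : ∀ w m n → w ℤ.+ + (m ℕ.+ n) ℤ.- + m ≡ w ℤ.+ + n
w+[m+n]-m≡w+n w m n = trans
  (cong (ℤ._- + m) (trans (cong (λ k → w ℤ.+ + k) (ℕₚ.+-comm m n)) (sym (w+m+n≡w+[m+n] w n m))))
  (ℤ-Group.//-rightDividesʳ (+ m) (w ℤ.+ + n))

-s+[s+n]≡n : ∀ s n → ℤ.- + s ℤ.+ + (s ℕ.+ n) ≡ + n
-s+[s+n]≡n s n = trans (ℤₚ.-m+n≡n⊖m s (s ℕ.+ n)) (trans (ℤₚ.⊖-≥ (ℕₚ.m≤m+n s n)) (cong +_ (ℕₚ.m+n∸m≡n s n)))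

-s+n≡-[1+s∸suc-n] : ∀ {s n} → n < s → ℤ.- + s ℤ.+ + n ≡ -[1+ s ℕ.∸ suc n ]
-s+n≡-[1+s∸suc-n] {s} {n} n<s = trans (ℤₚ.-m+n≡n⊖m s n) (trans (ℤₚ.⊖-< n<s) (cong (λ x → ℤ.- + x) (ℕₚ.+-∸-assoc 1 n<s)))

simplexCountℤ : ∀ {ℓ} → Vec ℕ ℓ → ℤ → ℚ
simplexCountℤ cs (+ n)    = fromℕ (simplexCount cs n)
simplexCountℤ cs -[1+ n ] = 0ℚ

Δ-simplexCountℤ : ∀ {ℓ} c (cs : Vec ℕ ℓ) → 1 ≤ c → ∀ t → Δ c (simplexCountℤ (c ∷ cs)) t ≡ simplexCountℤ cs t
Δ-simplexCountℤ (suc c′) cs _   -[1+ n ] = ℚₚ.+-inverseʳ 0ℚ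
Δ-simplexCountℤ c@(suc _) cs 1≤c (+ n) with c ≤? n | simplexCount-∷ c cs n 1≤c
... | yes c≤n | recurrence = begin
  fromℕ (simplexCount (c ∷ cs) n) - simplexCountℤ (c ∷ cs) (+ n ℤ.- + c)
    ≡⟨ cong₂ (λ x y → fromℕ x - simplexCountℤ (c ∷ cs) y) recurrence (trans (ℤₚ.m-n≡m⊖n n c) (ℤₚ.⊖-≥ c≤n)) ⟩
  fromℕ (simplexCount cs n ℕ.+ rest) - fromℕ rest
    ≡⟨ cong (_- fromℕ rest) (fromℕ-+ (simplexCount cs n) rest) ⟩
  (fromℕ (simplexCount cs n) + fromℕ rest) - fromℕ rest
    ≡⟨ solve 2 (λ a b → (a :+ b) :- b := a) refl (fromℕ (simplexCount cs n)) (fromℕ rest) ⟩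
  fromℕ (simplexCount cs n) ∎
  where
  open ≡-Reasoning
  rest = simplexCount (c ∷ cs) (n ℕ.∸ c)
... | no c≰n | recurrence = begin
  fromℕ (simplexCount (c ∷ cs) n) - simplexCountℤ (c ∷ cs) (+ n ℤ.- + c)
    ≡⟨ cong₂ (λ x y → fromℕ x - simplexCountℤ (c ∷ cs) y) (trans recurrence (ℕₚ.+-identityʳ _)) negative ⟩
  fromℕ (simplexCount cs n) - 0ℚ
    ≡⟨ solve 1 (λ a → a :- con 0ℚ := a) refl (fromℕ (simplexCount cs n)) ⟩
  fromℕ (simplexCount cs n) ∎
  where
  open ≡-Reasoning
  n<c = ℕₚ.≰⇒> c≰n
  negative : + n ℤ.- + c ≡ -[1+ c ℕ.∸ suc n ]
  negative = trans (ℤₚ.+-comm (+ n) (ℤ.- + c)) (-s+n≡-[1+s∸suc-n] n<c)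

Δs-simplexCountℤ : ∀ {ℓ} (cs : Vec ℕ ℓ) → VecAll.All (1 ≤_) cs → ∀ t → Δs (Vec.toList cs) (simplexCountℤ cs) t ≡ simplexCountℤ [] t
Δs-simplexCountℤ []       _            t = refl
Δs-simplexCountℤ (c ∷ cs) (1≤c ∷ 1≤cs) t =
  trans (Δs-cong (Vec.toList cs) (Δ-simplexCountℤ c cs 1≤c) t) (Δs-simplexCountℤ cs 1≤cs t)

-- Δ c f satisfies the hypotheses for cs from w + c on, and f t = Δ c f t + f (t - c).
vanishing-from-window : ∀ cs → ListAll.All (1 ≤_) cs → ∀ f w →
  (∀ n → sum cs ≤ n → Δs cs f (w ℤ.+ + n) ≡ 0ℚ) →
  (∀ n → n < sum cs → f (w ℤ.+ + n) ≡ 0ℚ) →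
  ∀ n → f (w ℤ.+ + n) ≡ 0ℚ
vanishing-from-window []       _            f w Δsf≡0 _      n = Δsf≡0 n z≤n
vanishing-from-window (c ∷ cs) (1≤c ∷ 1≤cs) f w Δsf≡0 window = <-rec (λ n → f (w ℤ.+ + n) ≡ 0ℚ) step
  where
  open ≡-Reasoning
  Δf≡0 : ∀ n → Δ c f (w ℤ.+ + c ℤ.+ + n) ≡ 0ℚ
  Δf≡0 = vanishing-from-window cs 1≤cs (Δ c f) (w ℤ.+ + c)
    (λ n Σ≤n → trans (cong (Δs cs (Δ c f)) (w+m+n≡w+[m+n] w c n)) (Δsf≡0 (c ℕ.+ n) (ℕₚ.+-monoʳ-≤ c Σ≤n)))
    (λ n n<Σ → begin
      f (w ℤ.+ + c ℤ.+ + n) - f (w ℤ.+ + c ℤ.+ + n ℤ.- + c)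
        ≡⟨ cong (λ t → f t - f (t ℤ.- + c)) (w+m+n≡w+[m+n] w c n) ⟩
      f (w ℤ.+ + (c ℕ.+ n)) - f (w ℤ.+ + (c ℕ.+ n) ℤ.- + c)
        ≡⟨ cong₂ (λ x y → f x - f y) refl (w+[m+n]-m≡w+n w c n) ⟩
      f (w ℤ.+ + (c ℕ.+ n)) - f (w ℤ.+ + n)
        ≡⟨ cong₂ _-_ (window (c ℕ.+ n) (ℕₚ.+-monoʳ-< c n<Σ)) (window n (ℕₚ.<-≤-trans n<Σ (ℕₚ.m≤n+m (sum cs) c))) ⟩
      0ℚ - 0ℚ ≡⟨⟩
      0ℚ ∎)
  step : ∀ n → (∀ {m} → m < n → f (w ℤ.+ + m) ≡ 0ℚ) → f (w ℤ.+ + n) ≡ 0ℚ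
  step n rec with n ℕ.<? c
  ... | yes n<c = window n (ℕₚ.<-≤-trans n<c (ℕₚ.m≤m+n c (sum cs)))
  ... | no n≮c = begin
    f (w ℤ.+ + n)                                     ≡⟨ cong (λ k → f (w ℤ.+ + k)) (sym c+m≡n) ⟩
    f (w ℤ.+ + (c ℕ.+ m))                             ≡⟨ solve 2 (λ a b → a := (a :- b) :+ b) refl (f (w ℤ.+ + (c ℕ.+ m))) (f (w ℤ.+ + (c ℕ.+ m) ℤ.- + c)) ⟩
    Δ c f (w ℤ.+ + (c ℕ.+ m)) + f (w ℤ.+ + (c ℕ.+ m) ℤ.- + c)
      ≡⟨ cong₂ _+_ (trans (cong (Δ c f) (sym (w+m+n≡w+[m+n] w c m))) (Δf≡0 m)) (cong f (w+[m+n]-m≡w+n w c m)) ⟩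
    0ℚ + f (w ℤ.+ + m)                                ≡⟨ cong (_+_ 0ℚ) (rec m<n) ⟩
    0ℚ + 0ℚ ≡⟨⟩
    0ℚ                                                ∎
    where
    m = n ℕ.∸ c
    c+m≡n = ℕₚ.m+[n∸m]≡n (ℕₚ.≮⇒≥ n≮c)
    m<n = ℕₚ.∸-monoʳ-< {n} {c} {0} 1≤c (ℕₚ.≮⇒≥ n≮c)

EhrhartDecomposition : RootSystem → Set
EhrhartDecomposition Φ = Σ[ Lk ∈ (ℕ → ℤ → ℚ) ]
  ((∀ (k : ℕ) → k ∈ distinctCoeffs Φ → QuasiPoly (Lk k) k (ℓ[ Φ ] k))
  × (∀ (q : ℕ) → (+ L Φ q) / 1 ≡ sumℚ (map (λ k → Lk k (+ q)) (distinctCoeffs Φ))))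

OneOrTwo : ℕ → Set
OneOrTwo c = c ≡ 1 ⊎ c ≡ 2

oneOrTwo⇒positive : ∀ {c} → OneOrTwo c → 1 ≤ c
oneOrTwo⇒positive (inj₁ refl) = s≤s z≤n
oneOrTwo⇒positive (inj₂ refl) = s≤s z≤n

replicate-oneOrTwo : ∀ m {c} → OneOrTwo c → VecAll.All OneOrTwo (replicate m c)
replicate-oneOrTwo zero    _ = []
replicate-oneOrTwo (suc m) c∈12 = c∈12 ∷ replicate-oneOrTwo m c∈12

cTail-oneOrTwo : ∀ n → VecAll.All OneOrTwo (cTail n)
cTail-oneOrTwo zero    = inj₁ refl ∷ []
cTail-oneOrTwo (suc n) = inj₂ refl ∷ cTail-oneOrTwo n

dTail-oneOrTwo : ∀ n → VecAll.All OneOrTwo (dTail n)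
dTail-oneOrTwo zero    = inj₂ refl ∷ inj₁ refl ∷ inj₁ refl ∷ []
dTail-oneOrTwo (suc n) = inj₂ refl ∷ dTail-oneOrTwo n

oneOrTwo-A : ∀ n → VecAll.All OneOrTwo (highestCoeffs (A n))
oneOrTwo-A n = replicate-oneOrTwo (suc n) (inj₁ refl)

oneOrTwo-B : ∀ n → VecAll.All OneOrTwo (highestCoeffs (B n))
oneOrTwo-B n = inj₁ refl ∷ replicate-oneOrTwo (suc n) (inj₂ refl)

oneOrTwo-C : ∀ n → VecAll.All OneOrTwo (highestCoeffs (C n))
oneOrTwo-C n = inj₂ refl ∷ inj₂ refl ∷ cTail-oneOrTwo n

oneOrTwo-D : ∀ n → VecAll.All OneOrTwo (highestCoeffs (D n))
oneOrTwo-D n = inj₁ refl ∷ dTail-oneOrTwo n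

allPositive : ∀ {ℓ} (cs : Vec ℕ ℓ) → {True (VecAll.all? (1 ≤?_) cs)} → VecAll.All (1 ≤_) cs
allPositive cs {ok} = toWitness ok

highestCoeffs-positive : ∀ Φ → VecAll.All (1 ≤_) (highestCoeffs Φ)
highestCoeffs-positive (A n) = VecAll.map oneOrTwo⇒positive (oneOrTwo-A n)
highestCoeffs-positive (B n) = VecAll.map oneOrTwo⇒positive (oneOrTwo-B n)
highestCoeffs-positive (C n) = VecAll.map oneOrTwo⇒positive (oneOrTwo-C n)
highestCoeffs-positive (D n) = VecAll.map oneOrTwo⇒positive (oneOrTwo-D n)
highestCoeffs-positive E6    = allPositive (highestCoeffs E6)
highestCoeffs-positive E7    = allPositive (highestCoeffs E7)
highestCoeffs-positive E8    = allPositive (highestCoeffs E8)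
highestCoeffs-positive F4    = allPositive (highestCoeffs F4)
highestCoeffs-positive G2    = allPositive (highestCoeffs G2)

coeffs-positive : ∀ Φ → ListAll.All (1 ≤_) (coeffs Φ)
coeffs-positive Φ = ℕₚ.≤-refl ∷ VecAllₚ.toList⁺ (highestCoeffs-positive Φ)

L≡simplexCount : ∀ Φ q → L Φ q ≡ simplexCount (highestCoeffs Φ) q
L≡simplexCount Φ q = simplexCount-box (highestCoeffs Φ) (highestCoeffs-positive Φ) q q ℕₚ.≤-refl

distinctCoeffs-positive : ∀ Φ {k} → k ∈ distinctCoeffs Φ → 1 ≤ k
distinctCoeffs-positive Φ k∈ = ListAll.lookup (coeffs-positive Φ) (∈-deduplicate⁻ ℕ._≟_ (coeffs Φ) k∈)

∈⇒1≤length : ∀ {A : Set} {x : A} {ys} → x ∈ ys → 1 ≤ length ys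
∈⇒1≤length {ys = _ ∷ _} _ = s≤s z≤n

suc-ℓ≤countDivisible : ∀ Φ {k} → k ∈ distinctCoeffs Φ → suc (ℓ[ Φ ] k) ≤ countDivisible k (coeffs Φ)
suc-ℓ≤countDivisible Φ {k} k∈ = ℕₚ.≤-reflexive (ℕₚ.m+[n∸m]≡n
  (∈⇒1≤length (∈-filter⁺ (k ∣?_) (∈-deduplicate⁻ ℕ._≟_ (coeffs Φ) k∈) ∣-refl)))

ℓ-1 : ∀ Φ → ℓ[ Φ ] 1 ≡ rank Φ
ℓ-1 Φ = trans (cong length (Listₚ.filter-all (1 ∣?_) (ListAll.universal 1∣_ (Vec.toList (highestCoeffs Φ)))))
  (Vecₚ.length-toList (highestCoeffs Φ))

Δs-coeffs-simplexCountℤ : ∀ Φ m → Δs (coeffs Φ) (simplexCountℤ (highestCoeffs Φ)) (+ suc m) ≡ 0ℚ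
Δs-coeffs-simplexCountℤ Φ m = trans (Δs-Δ (Vec.toList hc) 1 (simplexCountℤ hc) (+ suc m))
  (cong₂ _-_ (Δs-simplexCountℤ hc (highestCoeffs-positive Φ) (+ suc m)) (Δs-simplexCountℤ hc (highestCoeffs-positive Φ) (+ m)))
  where hc = highestCoeffs Φ

twos : ∀ {ℓ} → Vec ℕ ℓ → ℕ
twos cs = countDivisible 2 (Vec.toList cs)

twos≤length : ∀ {ℓ} (cs : Vec ℕ ℓ) → twos cs ≤ ℓ
twos≤length cs = ℕₚ.≤-trans (Listₚ.length-filter (2 ∣?_) (Vec.toList cs)) (ℕₚ.≤-reflexive (Vecₚ.length-toList cs))

twos-replicate-1 : ∀ m → twos (replicate m 1) ≡ 0
twos-replicate-1 zero    = refl
twos-replicate-1 (suc m) = twos-replicate-1 m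

-- deduplicate (x ∷ xs) = x ∷ without x (deduplicate xs)
without : ℕ → List ℕ → List ℕ
without x = filter (¬? ∘ ℕ._≟_ x)

dedup-replicate-1 : ∀ m → without 1 (deduplicate ℕ._≟_ (Vec.toList (replicate m 1))) ≡ []
dedup-replicate-1 zero    = refl
dedup-replicate-1 (suc m) rewrite dedup-replicate-1 m = refl

dedup-replicate-2 : ∀ m → deduplicate ℕ._≟_ (Vec.toList (replicate (suc m) 2)) ≡ 2 ∷ []
dedup-replicate-2 zero    = refl
dedup-replicate-2 (suc m) = cong (λ xs → 2 ∷ without 2 xs) (dedup-replicate-2 m)

dedup-cTail : ∀ m → deduplicate ℕ._≟_ (Vec.toList (cTail (suc m))) ≡ 2 ∷ 1 ∷ []
dedup-cTail zero    = refl
dedup-cTail (suc m) = cong (λ xs → 2 ∷ without 2 xs) (dedup-cTail m)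

dedup-dTail : ∀ m → deduplicate ℕ._≟_ (Vec.toList (dTail m)) ≡ 2 ∷ 1 ∷ []
dedup-dTail zero    = refl
dedup-dTail (suc m) = cong (λ xs → 2 ∷ without 2 xs) (dedup-dTail m)

distinctCoeffs-A : ∀ n → distinctCoeffs (A n) ≡ 1 ∷ []
distinctCoeffs-A n = cong (1 ∷_) (dedup-replicate-1 (suc n))

distinctCoeffs-B : ∀ n → distinctCoeffs (B n) ≡ 1 ∷ 2 ∷ []
distinctCoeffs-B n = cong (λ xs → 1 ∷ without 1 (1 ∷ without 1 xs)) (dedup-replicate-2 n)

distinctCoeffs-C : ∀ n → distinctCoeffs (C n) ≡ 1 ∷ 2 ∷ []
distinctCoeffs-C n = cong (λ xs → 1 ∷ without 1 xs) (dedup-cTail (suc n))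

distinctCoeffs-D : ∀ n → distinctCoeffs (D n) ≡ 1 ∷ 2 ∷ []
distinctCoeffs-D n = cong (λ xs → 1 ∷ without 1 (1 ∷ without 1 xs)) (dedup-dTail n)

-- Decompositions certified by computation

HasDegree : ∀ {k} → (Fin k → Poly) → ℕ → Set
HasDegree h d = (∀ j → length (h j) ≤ suc d) × ∃[ j ] coeff (h j) d ≢ 0ℚ

hasDegree? : ∀ {k} (h : Fin k → Poly) d → Dec (HasDegree h d)
hasDegree? h d = Finₚ.all? (λ j → length (h j) ℕ.≤? suc d) ×-dec Finₚ.any? (λ j → ¬? (coeff (h j) d ℚₚ.≟ 0ℚ))

quasiPoly-hasDegree : ∀ k .{{_ : NonZero k}} h d → HasDegree h d → QuasiPoly (quasiPoly k h) k d
quasiPoly-hasDegree k h d (short , top) =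
  quasiPoly-degree k h d (λ j → degreeBelow-weaken (h j) (short j) (degreeBelow-length (h j))) top

quasiPolySum : ((k : ℕ) → Fin k → Poly) → List ℕ → ℤ → ℚ
quasiPolySum h ks t = sumℚ (map (λ k → quasiPoly k (h k) t) ks)

sumℚ-zero : ∀ {A : Set} (F : A → ℚ) xs → (∀ {x} → x ∈ xs → F x ≡ 0ℚ) → sumℚ (map F xs) ≡ 0ℚ
sumℚ-zero F []       _    = refl
sumℚ-zero F (x ∷ xs) F≡0 rewrite F≡0 (here refl) | sumℚ-zero F xs (F≡0 ∘ there) = refl

-- the window is [- Σ_{i ≥ 1} c_i, 0], of length Σ_{i ≥ 0} c_i
windowStart : RootSystem → ℤ
windowStart Φ = ℤ.- + sum (Vec.toList (highestCoeffs Φ))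

Certificate : RootSystem → ((k : ℕ) → Fin k → Poly) → Set
Certificate Φ h = ListAll.All (λ k → HasDegree (h k) (ℓ[ Φ ] k)) (distinctCoeffs Φ)
  × (∀ {n} → n < sum (coeffs Φ) →
       simplexCountℤ (highestCoeffs Φ) (windowStart Φ ℤ.+ + n) ≡ quasiPolySum h (distinctCoeffs Φ) (windowStart Φ ℤ.+ + n))

certificate? : ∀ Φ h → Dec (Certificate Φ h)
certificate? Φ h = ListAll.all? (λ k → hasDegree? (h k) (ℓ[ Φ ] k)) (distinctCoeffs Φ)
  ×-dec ℕₚ.allUpTo? (λ n → simplexCountℤ (highestCoeffs Φ) (windowStart Φ ℤ.+ + n)
                           ℚₚ.≟ quasiPolySum h (distinctCoeffs Φ) (windowStart Φ ℤ.+ + n)) (sum (coeffs Φ))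

certified : ∀ Φ h → True (certificate? Φ h) → EhrhartDecomposition Φ
certified Φ h verified = (λ k → quasiPoly k (h k)) , periods , agreement
  where
  degrees = proj₁ (toWitness verified)
  window = proj₂ (toWitness verified)
  hc = highestCoeffs Φ
  ks = distinctCoeffs Φ
  S = sum (Vec.toList hc)
  G : ℤ → ℚ
  G t = simplexCountℤ hc t - quasiPolySum h ks t
  periods : ∀ k → k ∈ ks → QuasiPoly (quasiPoly k (h k)) k (ℓ[ Φ ] k)
  periods k k∈ = quasiPoly-hasDegree k {{ℕ.>-nonZero (distinctCoeffs-positive Φ k∈)}} (h k) (ℓ[ Φ ] k) (ListAll.lookup degrees k∈)
  Δs-parts : ∀ t → Δs (coeffs Φ) (quasiPolySum h ks) t ≡ 0ℚ
  Δs-parts t = trans (Δs-sum (coeffs Φ) (λ k → quasiPoly k (h k)) ks t) (sumℚ-zero _ ks λ {k} k∈ →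
    Δs-quasiPoly-vanishes k {{ℕ.>-nonZero (distinctCoeffs-positive Φ k∈)}} (coeffs Φ) (h k) (suc (ℓ[ Φ ] k))
      (λ j → degreeBelow-weaken (h k j) (proj₁ (ListAll.lookup degrees k∈) j) (degreeBelow-length (h k j)))
      (suc-ℓ≤countDivisible Φ k∈) t)
  Δs-G : ∀ n → suc S ≤ n → Δs (coeffs Φ) G (windowStart Φ ℤ.+ + n) ≡ 0ℚ
  Δs-G n S<n = begin
    Δs (coeffs Φ) G t                                                    ≡⟨ Δs-- (coeffs Φ) (simplexCountℤ hc) (quasiPolySum h ks) t ⟩
    Δs (coeffs Φ) (simplexCountℤ hc) t - Δs (coeffs Φ) (quasiPolySum h ks) t ≡⟨ cong₂ _-_ (trans (cong (Δs (coeffs Φ) (simplexCountℤ hc)) t≡) (Δs-coeffs-simplexCountℤ Φ m)) (Δs-parts t) ⟩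
    0ℚ - 0ℚ                                                              ≡⟨⟩
    0ℚ                                                                   ∎
    where
    open ≡-Reasoning
    t = windowStart Φ ℤ.+ + n
    m = n ℕ.∸ suc S
    t≡ : t ≡ + suc m
    t≡ = trans (cong (λ x → ℤ.- + S ℤ.+ + x) (trans (sym (ℕₚ.m+[n∸m]≡n S<n)) (sym (ℕₚ.+-suc S m)))) (-s+[s+n]≡n S (suc m))
  G≡0 : ∀ n → G (windowStart Φ ℤ.+ + n) ≡ 0ℚ
  G≡0 = vanishing-from-window (coeffs Φ) (coeffs-positive Φ) G (windowStart Φ) Δs-G
    (λ _ n<Σ → ℚ-Group.x≈y⇒x∙y⁻¹≈ε (window n<Σ))
  agreement : ∀ q → (+ L Φ q) / 1 ≡ quasiPolySum h ks (+ q)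
  agreement q = begin
    fromℕ (L Φ q)                       ≡⟨ cong fromℕ (L≡simplexCount Φ q) ⟩
    simplexCountℤ hc (+ q)              ≡⟨ ℚ-Group.x∙y⁻¹≈ε⇒x≈y _ _ (trans (cong G (sym (-s+[s+n]≡n S q))) (G≡0 (S ℕ.+ q))) ⟩
    quasiPolySum h ks (+ q)             ∎
    where open ≡-Reasoning

-- The classical types

iterate : ∀ {A : Set} → (A → A) → ℕ → A → A
iterate f zero    x = x
iterate f (suc n) x = f (iterate f n x)

1/2[1+_] : ℕ → ℚ
1/2[1+ N ] = 1/suc (ℕ.pred (2 ℕ.* suc N))

2[1+N]*1/2[1+N] : ∀ N → fromℕ (2 ℕ.* suc N) * 1/2[1+ N ] ≡ 1ℚ
2[1+N]*1/2[1+N] N = fromℕ-suc*1/suc (ℕ.pred (2 ℕ.* suc N))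

-- ∏_{j=1}^N (t + 2j)/(2j) = binom(t/2 + N, N)
halfBinom : ℕ → ℤ → ℚ
halfBinom zero    t = 1ℚ
halfBinom (suc N) t = halfBinom N t * ((fromℤ t + fromℕ (2 ℕ.* suc N)) * 1/2[1+ N ])

fromℤ-sub2+2[1+m] : ∀ t m → fromℤ (t ℤ.- + 2) + fromℕ (2 ℕ.* suc m) ≡ fromℤ t + fromℕ (2 ℕ.* m)
fromℤ-sub2+2[1+m] t m = trans
  (cong₂ _+_ (fromℤ-- t (+ 2)) (trans (cong fromℕ (ℕₚ.*-suc 2 m)) (fromℕ-+ 2 (2 ℕ.* m))))
  (solve 3 (λ x c d → (x :- c) :+ (c :+ d) := x :+ d) refl (fromℤ t) (fromℕ 2) (fromℕ (2 ℕ.* m)))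

halfBinom-sub2 : ∀ N t → halfBinom (suc N) (t ℤ.- + 2) ≡ halfBinom N t * (fromℤ t * 1/2[1+ N ])
halfBinom-sub2 zero    t = begin
  1ℚ * ((fromℤ (t ℤ.- + 2) + fromℕ 2) * b)   ≡⟨ cong (λ y → 1ℚ * (y * b)) (fromℤ-sub2+2[1+m] t 0) ⟩
  1ℚ * ((fromℤ t + 0ℚ) * b)                  ≡⟨ solve 2 (λ x b → con 1ℚ :* ((x :+ con 0ℚ) :* b) := con 1ℚ :* (x :* b)) refl (fromℤ t) b ⟩
  1ℚ * (fromℤ t * b)                         ∎
  where
  open ≡-Reasoning
  b = 1/2[1+ 0 ]
halfBinom-sub2 (suc N) t = begin
  halfBinom (suc N) (t ℤ.- + 2) * ((fromℤ (t ℤ.- + 2) + fromℕ (2 ℕ.* suc (suc N))) * b′)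
    ≡⟨ cong₂ (λ y z → y * (z * b′)) (halfBinom-sub2 N t) (fromℤ-sub2+2[1+m] t (suc N)) ⟩
  halfBinom N t * (fromℤ t * b) * ((fromℤ t + c) * b′)
    ≡⟨ solve 5 (λ p x c b b′ → p :* (x :* b) :* ((x :+ c) :* b′) := p :* ((x :+ c) :* b) :* (x :* b′))
         refl (halfBinom N t) (fromℤ t) c b b′ ⟩
  halfBinom N t * ((fromℤ t + c) * b) * (fromℤ t * b′) ∎
  where
  open ≡-Reasoning
  c = fromℕ (2 ℕ.* suc N)
  b = 1/2[1+ N ]
  b′ = 1/2[1+ suc N ]

Δ2-halfBinom : ∀ N t → Δ 2 (halfBinom (suc N)) t ≡ halfBinom N t
Δ2-halfBinom N t rewrite halfBinom-sub2 N t = begin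
  p * ((x + c) * b) - p * (x * b) ≡⟨ solve 4 (λ p x c b → p :* ((x :+ c) :* b) :- p :* (x :* b) := p :* (c :* b)) refl p x c b ⟩
  p * (c * b)                     ≡⟨ cong (p *_) (2[1+N]*1/2[1+N] N) ⟩
  p * 1ℚ                          ≡⟨ ℚₚ.*-identityʳ p ⟩
  p                               ∎
  where
  open ≡-Reasoning
  p = halfBinom N t
  x = fromℤ t
  c = fromℕ (2 ℕ.* suc N)
  b = 1/2[1+ N ]

halfBinom-vanishes : ∀ N j → 1 ≤ j → j ≤ N → halfBinom N (ℤ.- + (2 ℕ.* j)) ≡ 0ℚ
halfBinom-vanishes zero    (suc j) _   ()
halfBinom-vanishes (suc N) j 1≤j j≤1+N with ℕₚ.m≤n⇒m<n∨m≡n j≤1+N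
... | inj₁ j≤N = trans (cong (_* ((fromℤ t + c) * b)) (halfBinom-vanishes N j 1≤j (ℕₚ.≤-pred j≤N)))
  (ℚₚ.*-zeroˡ ((fromℤ t + c) * b))
  where
  t = ℤ.- + (2 ℕ.* j)
  c = fromℕ (2 ℕ.* suc N)
  b = 1/2[1+ N ]
... | inj₂ refl = begin
  halfBinom N t * ((fromℤ t + c) * b) ≡⟨ cong (λ y → halfBinom N t * ((y + c) * b)) (fromℤ-neg (+ (2 ℕ.* suc N))) ⟩
  halfBinom N t * ((- c + c) * b)     ≡⟨ cong (λ y → halfBinom N t * (y * b)) (ℚₚ.+-inverseˡ c) ⟩
  halfBinom N t * (0ℚ * b)            ≡⟨ solve 2 (λ p b → p :* (con 0ℚ :* b) := con 0ℚ) refl (halfBinom N t) b ⟩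
  0ℚ                                  ∎
  where
  open ≡-Reasoning
  t = ℤ.- + (2 ℕ.* suc N)
  c = fromℕ (2 ℕ.* suc N)
  b = 1/2[1+ N ]

halfBinomₚ : ℕ → Poly
halfBinomₚ zero    = 1ℚ ∷ []
halfBinomₚ (suc N) = mulLinear (fromℕ (2 ℕ.* suc N) * 1/2[1+ N ]) 1/2[1+ N ] (halfBinomₚ N)

eval-halfBinomₚ : ∀ N t → eval (halfBinomₚ N) t ≡ halfBinom N t
eval-halfBinomₚ zero    t = solve 1 (λ x → con 1ℚ :+ x :* con 0ℚ := con 1ℚ) refl (fromℤ t)
eval-halfBinomₚ (suc N) t rewrite eval-mulLinear (fromℕ (2 ℕ.* suc N) * 1/2[1+ N ]) 1/2[1+ N ] (halfBinomₚ N) t | eval-halfBinomₚ N t =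
  solve 4 (λ c b x p → (c :* b :+ b :* x) :* p := p :* ((x :+ c) :* b)) refl (fromℕ (2 ℕ.* suc N)) 1/2[1+ N ] (fromℤ t) (halfBinom N t)

degreeBelow-halfBinomₚ : ∀ N → DegreeBelow (halfBinomₚ N) (suc N)
degreeBelow-halfBinomₚ zero    = degreeBelow-length (1ℚ ∷ [])
degreeBelow-halfBinomₚ (suc N) = degreeBelow-mulLinear _ 1/2[1+ N ] (halfBinomₚ N) (degreeBelow-halfBinomₚ N)

halfBinomₚ-leading-positive : ∀ N → Positive (coeff (halfBinomₚ N) N)
halfBinomₚ-leading-positive zero    = _
halfBinomₚ-leading-positive (suc N) = subst Positive (sym leading)
  (ℚₚ.pos*pos⇒pos 1/2[1+ N ] (coeff (halfBinomₚ N) N) {{halfBinomₚ-leading-positive N}})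
  where
  α = fromℕ (2 ℕ.* suc N) * 1/2[1+ N ]
  leading : coeff (halfBinomₚ (suc N)) (suc N) ≡ 1/2[1+ N ] * coeff (halfBinomₚ N) N
  leading = begin
    coeff (halfBinomₚ (suc N)) (suc N)
      ≡⟨ coeff-mulLinear-suc α 1/2[1+ N ] (halfBinomₚ N) N ⟩
    α * coeff (halfBinomₚ N) (suc N) + 1/2[1+ N ] * coeff (halfBinomₚ N) N
      ≡⟨ cong (λ x → α * x + 1/2[1+ N ] * coeff (halfBinomₚ N) N) (degreeBelow-halfBinomₚ N (suc N) ℕₚ.≤-refl) ⟩
    α * 0ℚ + 1/2[1+ N ] * coeff (halfBinomₚ N) N
      ≡⟨ solve 3 (λ α b c → α :* con 0ℚ :+ b :* c := b :* c) refl α 1/2[1+ N ] (coeff (halfBinomₚ N) N) ⟩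
    1/2[1+ N ] * coeff (halfBinomₚ N) N ∎
    where open ≡-Reasoning

residue2-sub2 : ∀ t → residue 2 (t ℤ.- + 2) ≡ residue 2 t
residue2-sub2 t = residue-periodic 2 t (ℤ.- + 1)

½ : ℚ
½ = 1/suc 1

sign : Fin 2 → ℚ
sign zero       = 1ℚ
sign (suc zero) = - 1ℚ

sign-sub1 : ∀ t → sign (residue 2 (t ℤ.- + 1)) ≡ - sign (residue 2 t)
sign-sub1 t rewrite residue-sub 2 t 1 with residue 2 t
... | zero     = refl
... | suc zero = refl

onEven : Fin 2 → ℚ → ℚ
onEven zero       x = x
onEven (suc zero) x = 0ℚ

onEven+onEven-sub1 : ∀ t x → onEven (residue 2 t) x + onEven (residue 2 (t ℤ.- + 1)) x ≡ x
onEven+onEven-sub1 t x rewrite residue-sub 2 t 1 with residue 2 t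
... | zero     = ℚₚ.+-identityʳ x
... | suc zero = ℚₚ.+-identityˡ x

onEven-split : ∀ r x → onEven r x ≡ ½ * x + sign r * (½ * x)
onEven-split zero       x = solve 1 (λ x → x := con ½ :* x :+ con 1ℚ :* (con ½ :* x)) refl x
onEven-split (suc zero) x = solve 1 (λ x → con 0ℚ := con ½ :* x :+ con (- 1ℚ) :* (con ½ :* x)) refl x

residue2-negative-+2 : ∀ n → residue 2 -[1+ suc (suc n) ] ≡ residue 2 -[1+ n ]
residue2-negative-+2 n = trans (cong (λ x → residue 2 -[1+ suc x ]) (ℕₚ.+-comm 1 n)) (residue-periodic 2 -[1+ n ] (ℤ.- + 1))

residue2-negative : ∀ n → ∃[ m ] ((n ≡ 2 ℕ.* m × residue 2 -[1+ n ] ≡ suc zero)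
                                ⊎ (n ≡ suc (2 ℕ.* m) × residue 2 -[1+ n ] ≡ zero))
residue2-negative zero          = 0 , inj₁ (refl , refl)
residue2-negative (suc zero)    = 0 , inj₂ (refl , refl)
residue2-negative (suc (suc n)) with residue2-negative n
... | m , inj₁ (refl , r) = suc m , inj₁ (sym (ℕₚ.*-suc 2 m) , trans (residue2-negative-+2 n) r)
... | m , inj₂ (refl , r) = suc m , inj₂ (cong suc (sym (ℕₚ.*-suc 2 m)) , trans (residue2-negative-+2 n) r)

evenBinom : ℕ → ℤ → ℚ
evenBinom N t = onEven (residue 2 t) (halfBinom N t)

Δ2-evenBinom : ∀ N t → Δ 2 (evenBinom (suc N)) t ≡ evenBinom N t
Δ2-evenBinom N t rewrite residue2-sub2 t with residue 2 t
... | zero     = Δ2-halfBinom N t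
... | suc zero = ℚₚ.+-inverseʳ 0ℚ

VanishesBelow : (ℤ → ℚ) → ℕ → Set
VanishesBelow f u = ∀ n → n < u → f -[1+ n ] ≡ 0ℚ

evenBinom-vanishes : ∀ N → VanishesBelow (evenBinom N) (suc (2 ℕ.* N))
evenBinom-vanishes N n (s≤s n≤2N) with residue2-negative n
... | m , inj₁ (_ , odd) rewrite odd = refl
... | m , inj₂ (refl , even) rewrite even =
  trans (cong (λ x → halfBinom N (ℤ.- + x)) (sym (ℕₚ.*-suc 2 m)))
        (halfBinom-vanishes N (suc m) (s≤s z≤n) (ℕₚ.*-cancelˡ-< 2 m N n≤2N))

Δ⁺ : (ℤ → ℚ) → ℤ → ℚ
Δ⁺ f t = f t + f (t ℤ.- + 1)

iterate-Δ⁺-cong : ∀ a {f g} → (∀ t → f t ≡ g t) → ∀ t → iterate Δ⁺ a f t ≡ iterate Δ⁺ a g t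
iterate-Δ⁺-cong zero    f≗g = f≗g
iterate-Δ⁺-cong (suc a) f≗g t = cong₂ _+_ (iterate-Δ⁺-cong a f≗g t) (iterate-Δ⁺-cong a f≗g (t ℤ.- + 1))

Δ-Δ⁺ : ∀ c f t → Δ c (Δ⁺ f) t ≡ Δ⁺ (Δ c f) t
Δ-Δ⁺ c f t rewrite ℤ-Comm.xy∙z≈xz∙y t (ℤ.- + c) (ℤ.- + 1) =
  solve 4 (λ a b a′ b′ → (a :+ b) :- (a′ :+ b′) := (a :- a′) :+ (b :- b′))
    refl (f t) (f (t ℤ.- + 1)) (f (t ℤ.- + c)) (f (t ℤ.- + 1 ℤ.- + c))

Δ-iterate-Δ⁺ : ∀ c a f t → Δ c (iterate Δ⁺ a f) t ≡ iterate Δ⁺ a (Δ c f) t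
Δ-iterate-Δ⁺ c zero    f t = refl
Δ-iterate-Δ⁺ c (suc a) f t = trans (Δ-Δ⁺ c (iterate Δ⁺ a f) t)
  (cong₂ _+_ (Δ-iterate-Δ⁺ c a f t) (Δ-iterate-Δ⁺ c a f (t ℤ.- + 1)))

Δ1-Δ⁺ : ∀ f t → Δ 1 (Δ⁺ f) t ≡ Δ 2 f t
Δ1-Δ⁺ f t rewrite ℤₚ.+-assoc t (ℤ.- + 1) (ℤ.- + 1) =
  solve 3 (λ a b c → (a :+ b) :- (b :+ c) := a :- c) refl (f t) (f (t ℤ.- + 1)) (f (t ℤ.- + 2))

Δ⁺-vanishes : ∀ f u → VanishesBelow f (suc u) → VanishesBelow (Δ⁺ f) u
Δ⁺-vanishes f u f≡0 n n<u = trans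
  (cong₂ _+_ (f≡0 n (ℕₚ.m≤n⇒m≤1+n n<u)) (trans (cong (λ x → f -[1+ suc x ]) (ℕₚ.+-identityʳ n)) (f≡0 (suc n) (s≤s n<u))))
  (ℚₚ.+-identityˡ 0ℚ)

closedForm : ℕ → ℕ → ℤ → ℚ
closedForm a N = iterate Δ⁺ a (evenBinom N)

Δ1-closedForm : ∀ a N t → Δ 1 (closedForm (suc a) (suc N)) t ≡ closedForm a N t
Δ1-closedForm a N t = trans (Δ1-Δ⁺ (closedForm a (suc N)) t)
  (trans (Δ-iterate-Δ⁺ 2 a (evenBinom (suc N)) t) (iterate-Δ⁺-cong a (Δ2-evenBinom N) t))

Δ2-closedForm : ∀ a N t → Δ 2 (closedForm a (suc N)) t ≡ closedForm a N t
Δ2-closedForm a N t = trans (Δ-iterate-Δ⁺ 2 a (evenBinom (suc N)) t) (iterate-Δ⁺-cong a (Δ2-evenBinom N) t)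

closedForm-vanishes : ∀ a N u → u ℕ.+ a ≤ suc (2 ℕ.* N) → VanishesBelow (closedForm a N) u
closedForm-vanishes zero    N u u≤ n n<u = evenBinom-vanishes N n (ℕₚ.<-≤-trans n<u (subst (_≤ suc (2 ℕ.* N)) (ℕₚ.+-identityʳ u) u≤))
closedForm-vanishes (suc a) N u u≤ = Δ⁺-vanishes (closedForm a N) u
  (closedForm-vanishes a N (suc u) (subst (_≤ suc (2 ℕ.* N)) (ℕₚ.+-suc u a) u≤))

closedForm-1-0 : ∀ t → closedForm 1 0 t ≡ 1ℚ
closedForm-1-0 t = onEven+onEven-sub1 t 1ℚ

-- The difference of the two sides is killed by Δ c on ℕ and vanishes on [-c, -1].
simplexCount-∷-closedForm : ∀ {ℓ} c (cs : Vec ℕ ℓ) (F G : ℤ → ℚ) → 1 ≤ c → (∀ t → Δ c G t ≡ F t) →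
  (∀ n → fromℕ (simplexCount cs n) ≡ F (+ n)) → VanishesBelow G c →
  ∀ n → fromℕ (simplexCount (c ∷ cs) n) ≡ G (+ n)
simplexCount-∷-closedForm c cs F G 1≤c ΔG≡F count≡F G≡0 n = ℚ-Group.x∙y⁻¹≈ε⇒x≈y _ _
  (trans (cong H (sym (-s+[s+n]≡n c n))) (vanishing-from-window (c ∷ []) (1≤c ∷ []) H (ℤ.- + c) ΔH≡0 window (c ℕ.+ n)))
  where
  H : ℤ → ℚ
  H t = simplexCountℤ (c ∷ cs) t - G t
  ΔH≡0 : ∀ m → c ℕ.+ 0 ≤ m → Δ c H (ℤ.- + c ℤ.+ + m) ≡ 0ℚ
  ΔH≡0 m c≤m rewrite sym (ℕₚ.m+[n∸m]≡n (subst (_≤ m) (ℕₚ.+-identityʳ c) c≤m)) | -s+[s+n]≡n c (m ℕ.∸ c) =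
    trans (Δs-- (c ∷ []) (simplexCountℤ (c ∷ cs)) G (+ (m ℕ.∸ c)))
      (trans (cong₂ _-_ (Δ-simplexCountℤ c cs 1≤c (+ (m ℕ.∸ c))) (ΔG≡F (+ (m ℕ.∸ c))))
        (ℚ-Group.x≈y⇒x∙y⁻¹≈ε (count≡F (m ℕ.∸ c))))
  window : ∀ m → m < c ℕ.+ 0 → H (ℤ.- + c ℤ.+ + m) ≡ 0ℚ
  window m m<c rewrite -s+n≡-[1+s∸suc-n] (subst (m <_) (ℕₚ.+-identityʳ c) m<c) =
    trans (cong (_-_ 0ℚ) (G≡0 (c ℕ.∸ suc m) (ℕₚ.∸-monoʳ-< {c} {suc m} {0} (s≤s z≤n) (subst (m <_) (ℕₚ.+-identityʳ c) m<c)))) (ℚₚ.+-inverseʳ 0ℚ)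

exponent-bound : ∀ {a ℓ} → a ≤ suc ℓ → suc (suc a) ≤ suc (2 ℕ.* suc ℓ)
exponent-bound {a} {ℓ} a≤ = s≤s (s≤s (ℕₚ.≤-trans a≤
  (ℕₚ.≤-trans (s≤s (ℕₚ.m≤m+n ℓ (ℓ ℕ.+ 0))) (ℕₚ.≤-reflexive (sym (ℕₚ.+-suc ℓ (ℓ ℕ.+ 0)))))))

simplexCount-closedForm : ∀ {ℓ} (cs : Vec ℕ ℓ) → VecAll.All OneOrTwo cs →
  ∀ n → fromℕ (simplexCount cs n) ≡ closedForm (suc ℓ ℕ.∸ twos cs) ℓ (+ n)
simplexCount-closedForm []       []                n = sym (closedForm-1-0 (+ n))
simplexCount-closedForm {suc ℓ} (c ∷ cs) (inj₁ refl ∷ cs∈12) =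
  subst (λ a′ → ∀ n → fromℕ (simplexCount (1 ∷ cs) n) ≡ closedForm a′ (suc ℓ) (+ n))
    (sym (ℕₚ.+-∸-assoc 1 (ℕₚ.m≤n⇒m≤1+n (twos≤length cs))))
    (simplexCount-∷-closedForm 1 cs (closedForm a ℓ) (closedForm (suc a) (suc ℓ)) ℕₚ.≤-refl (Δ1-closedForm a ℓ)
      (simplexCount-closedForm cs cs∈12) (closedForm-vanishes (suc a) (suc ℓ) 1 (exponent-bound (ℕₚ.m∸n≤m (suc ℓ) (twos cs)))))
  where a = suc ℓ ℕ.∸ twos cs
simplexCount-closedForm {suc ℓ} (c ∷ cs) (inj₂ refl ∷ cs∈12) =
  simplexCount-∷-closedForm 2 cs (closedForm a ℓ) (closedForm a (suc ℓ)) (s≤s z≤n) (Δ2-closedForm a ℓ)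
    (simplexCount-closedForm cs cs∈12) (closedForm-vanishes a (suc ℓ) 2 (exponent-bound (ℕₚ.m∸n≤m (suc ℓ) (twos cs))))
  where a = suc ℓ ℕ.∸ twos cs

plusₚ : Poly → Poly
plusₚ p = p +ₚ shiftₚ 1 p

diffₚ : Poly → Poly
diffₚ p = p -ₚ shiftₚ 1 p

eval-plusₚ : ∀ p t → eval (plusₚ p) t ≡ eval p t + eval p (t ℤ.- + 1)
eval-plusₚ p t = trans (eval-+ₚ p (shiftₚ 1 p) t) (cong (_+_ (eval p t)) (eval-shiftₚ 1 p t))

eval-diffₚ : ∀ p t → eval (diffₚ p) t ≡ eval p t - eval p (t ℤ.- + 1)
eval-diffₚ p t = trans (eval--ₚ p (shiftₚ 1 p) t) (cong (_-_ (eval p t)) (eval-shiftₚ 1 p t))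

coeff-plusₚ-leading : ∀ p d → DegreeBelow p (suc d) → coeff (plusₚ p) d ≡ fromℕ 2 * coeff p d
coeff-plusₚ-leading p d p<d = begin
  coeff (plusₚ p) d                 ≡⟨ coeff-+ₚ p (shiftₚ 1 p) d ⟩
  coeff p d + coeff (shiftₚ 1 p) d  ≡⟨ cong (_+_ (coeff p d)) (coeff-shiftₚ-leading 1 p d p<d) ⟩
  coeff p d + coeff p d             ≡⟨ solve 1 (λ c → c :+ c := con (fromℕ 2) :* c) refl (coeff p d) ⟩
  fromℕ 2 * coeff p d               ∎
  where open ≡-Reasoning

coeff-diffₚ-leading : ∀ p d → DegreeBelow p (suc (suc d)) → coeff (diffₚ p) d ≡ fromℕ (suc d) * coeff p (suc d)
coeff-diffₚ-leading p d p<d = begin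
  coeff (diffₚ p) d                                ≡⟨ coeff-+ₚ p ((- 1ℚ) *ₚ shiftₚ 1 p) d ⟩
  coeff p d + coeff ((- 1ℚ) *ₚ shiftₚ 1 p) d        ≡⟨ cong (_+_ (coeff p d)) (coeff-*ₚ (- 1ℚ) (shiftₚ 1 p) d) ⟩
  coeff p d + (- 1ℚ) * coeff (shiftₚ 1 p) d        ≡⟨ cong (λ x → coeff p d + (- 1ℚ) * x) (coeff-shiftₚ-subleading 1 p d p<d) ⟩
  coeff p d + (- 1ℚ) * (coeff p d - fromℕ (suc d) * 1ℚ * coeff p (suc d))
    ≡⟨ solve 3 (λ c e c′ → c :+ con (- 1ℚ) :* (c :- e :* con 1ℚ :* c′) := e :* c′) refl (coeff p d) (fromℕ (suc d)) (coeff p (suc d)) ⟩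
  fromℕ (suc d) * coeff p (suc d)                  ∎
  where open ≡-Reasoning

degreeBelow-plusₚ^ : ∀ a p d → DegreeBelow p d → DegreeBelow (iterate plusₚ a p) d
degreeBelow-plusₚ^ zero    p d p<d = p<d
degreeBelow-plusₚ^ (suc a) p d p<d = degreeBelow-+ₚ q (shiftₚ 1 q) q<d (degreeBelow-shiftₚ 1 q q<d)
  where
  q = iterate plusₚ a p
  q<d = degreeBelow-plusₚ^ a p d p<d

plusₚ^-leading-positive : ∀ a p d → DegreeBelow p (suc d) → Positive (coeff p d) → Positive (coeff (iterate plusₚ a p) d)
plusₚ^-leading-positive zero    p d _   pos = pos
plusₚ^-leading-positive (suc a) p d p<d pos =
  subst Positive (sym (coeff-plusₚ-leading q d (degreeBelow-plusₚ^ a p (suc d) p<d)))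
    (ℚₚ.pos*pos⇒pos (fromℕ 2) {{fromℕ-suc-positive 1}} (coeff q d) {{plusₚ^-leading-positive a p d p<d pos}})
  where q = iterate plusₚ a p

degreeBelow-diffₚ^ : ∀ a p d → DegreeBelow p (a ℕ.+ d) → DegreeBelow (iterate diffₚ a p) d
degreeBelow-diffₚ^ zero    p d p<d = p<d
degreeBelow-diffₚ^ (suc a) p d p<d =
  degreeBelow-sub-shiftₚ 1 (iterate diffₚ a p) d (degreeBelow-diffₚ^ a p (suc d) (subst (DegreeBelow p) (sym (ℕₚ.+-suc a d)) p<d))

diffₚ^-leading-positive : ∀ a p d → DegreeBelow p (suc (a ℕ.+ d)) → Positive (coeff p (a ℕ.+ d)) →
  Positive (coeff (iterate diffₚ a p) d)
diffₚ^-leading-positive zero    p d _   pos = pos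
diffₚ^-leading-positive (suc a) p d p<d pos =
  subst Positive (sym (coeff-diffₚ-leading q d (degreeBelow-diffₚ^ a p (suc (suc d)) (subst (DegreeBelow p) a+[d+2]≡ p<d))))
    (ℚₚ.pos*pos⇒pos (fromℕ (suc d)) {{fromℕ-suc-positive d}} (coeff q (suc d))
      {{diffₚ^-leading-positive a p (suc d) (subst (λ x → DegreeBelow p (suc x)) (sym (ℕₚ.+-suc a d)) p<d)
          (subst (λ x → Positive (coeff p x)) (sym (ℕₚ.+-suc a d)) pos)}})
  where
  q = iterate diffₚ a p
  a+[d+2]≡ : suc (suc a ℕ.+ d) ≡ a ℕ.+ suc (suc d)
  a+[d+2]≡ = sym (trans (ℕₚ.+-suc a (suc d)) (cong suc (ℕₚ.+-suc a d)))

polynomialPartₚ : ℕ → ℕ → Poly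
polynomialPartₚ a N = iterate plusₚ a (½ *ₚ halfBinomₚ N)

alternatingPartₚ : ℕ → ℕ → Poly
alternatingPartₚ a N = iterate diffₚ a (½ *ₚ halfBinomₚ N)

-- evenBinom N = ½ P + ½ (-1)^t P, and (1 + E) turns (-1)^t Q into (-1)^t (1 - E) Q
closedForm-split : ∀ a N t → closedForm a N t ≡ eval (polynomialPartₚ a N) t + sign (residue 2 t) * eval (alternatingPartₚ a N) t
closedForm-split zero    N t = begin
  onEven (residue 2 t) (halfBinom N t)                                  ≡⟨ onEven-split (residue 2 t) (halfBinom N t) ⟩
  ½ * halfBinom N t + sign (residue 2 t) * (½ * halfBinom N t)          ≡⟨ cong (λ x → ½ * x + sign (residue 2 t) * (½ * x)) (sym (eval-halfBinomₚ N t)) ⟩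
  ½ * eval P t + sign (residue 2 t) * (½ * eval P t)                    ≡⟨ cong (λ x → x + sign (residue 2 t) * x) (sym (eval-*ₚ ½ P t)) ⟩
  eval (½ *ₚ P) t + sign (residue 2 t) * eval (½ *ₚ P) t                ∎
  where
  open ≡-Reasoning
  P = halfBinomₚ N
closedForm-split (suc a) N t = begin
  closedForm a N t + closedForm a N t′
    ≡⟨ cong₂ _+_ (closedForm-split a N t) (closedForm-split a N t′) ⟩
  (eval E t + sign (residue 2 t) * eval Q t) + (eval E t′ + sign (residue 2 t′) * eval Q t′)
    ≡⟨ cong (λ s → (eval E t + sign (residue 2 t) * eval Q t) + (eval E t′ + s * eval Q t′)) (sign-sub1 t) ⟩
  (eval E t + sign (residue 2 t) * eval Q t) + (eval E t′ + - sign (residue 2 t) * eval Q t′)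
    ≡⟨ solve 5 (λ e s q e′ q′ → (e :+ s :* q) :+ (e′ :+ (:- s) :* q′) := (e :+ e′) :+ s :* (q :- q′))
         refl (eval E t) (sign (residue 2 t)) (eval Q t) (eval E t′) (eval Q t′) ⟩
  (eval E t + eval E t′) + sign (residue 2 t) * (eval Q t - eval Q t′)
    ≡⟨ sym (cong₂ (λ x y → x + sign (residue 2 t) * y) (eval-plusₚ E t) (eval-diffₚ Q t)) ⟩
  eval (plusₚ E) t + sign (residue 2 t) * eval (diffₚ Q) t ∎
  where
  open ≡-Reasoning
  t′ = t ℤ.- + 1
  E = polynomialPartₚ a N
  Q = alternatingPartₚ a N

signed : Poly → Fin 2 → Poly
signed Q j = sign j *ₚ Q

quasiPoly-signed : ∀ Q t → quasiPoly 2 (signed Q) t ≡ sign (residue 2 t) * eval Q t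
quasiPoly-signed Q t = eval-*ₚ (sign (residue 2 t)) Q t

½P-degreeBelow : ∀ N → DegreeBelow (½ *ₚ halfBinomₚ N) (suc N)
½P-degreeBelow N = degreeBelow-*ₚ ½ (halfBinomₚ N) (degreeBelow-halfBinomₚ N)

½P-leading-positive : ∀ N → Positive (coeff (½ *ₚ halfBinomₚ N) N)
½P-leading-positive N = subst Positive (sym (coeff-*ₚ ½ (halfBinomₚ N) N))
  (ℚₚ.pos*pos⇒pos ½ (coeff (halfBinomₚ N) N) {{halfBinomₚ-leading-positive N}})

polynomialPart-quasiPoly : ∀ a N → QuasiPoly (quasiPoly 1 (λ _ → polynomialPartₚ a N)) 1 N
polynomialPart-quasiPoly a N = quasiPoly-degree 1 (λ _ → polynomialPartₚ a N) N
  (λ _ → degreeBelow-plusₚ^ a (½ *ₚ halfBinomₚ N) (suc N) (½P-degreeBelow N))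
  (zero , pos⇒≢0 _ (plusₚ^-leading-positive a (½ *ₚ halfBinomₚ N) N (½P-degreeBelow N) (½P-leading-positive N)))

alternatingPart-quasiPoly : ∀ a d N → a ℕ.+ d ≡ N → QuasiPoly (quasiPoly 2 (signed (alternatingPartₚ a N))) 2 d
alternatingPart-quasiPoly a d N refl = quasiPoly-degree 2 (signed Q) d
  (λ j → degreeBelow-*ₚ (sign j) Q (degreeBelow-diffₚ^ a (½ *ₚ halfBinomₚ N) (suc d)
            (subst (DegreeBelow (½ *ₚ halfBinomₚ N)) (sym (ℕₚ.+-suc a d)) (½P-degreeBelow N))))
  (zero , λ c≡0 → pos⇒≢0 _ (diffₚ^-leading-positive a (½ *ₚ halfBinomₚ N) d (½P-degreeBelow N) (½P-leading-positive N))
                    (trans (sym (ℚₚ.*-identityˡ (coeff Q d))) (trans (sym (coeff-*ₚ 1ℚ Q d)) c≡0)))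
  where Q = alternatingPartₚ a N

alternatingPart-vanishes : ∀ N t → eval (alternatingPartₚ (suc N) N) t ≡ 0ℚ
alternatingPart-vanishes N = eval-degreeBelow-0 (alternatingPartₚ (suc N) N)
  (degreeBelow-diffₚ^ (suc N) (½ *ₚ halfBinomₚ N) 0 (subst (DegreeBelow (½ *ₚ halfBinomₚ N)) (sym (ℕₚ.+-identityʳ (suc N))) (½P-degreeBelow N)))

[1+n∸t]+[t∸1]≡n : ∀ {t n} → 1 ≤ t → t ≤ n → (suc n ℕ.∸ t) ℕ.+ (t ℕ.∸ 1) ≡ n
[1+n∸t]+[t∸1]≡n {suc t} _ t<n = ℕₚ.m∸n+n≡m (ℕₚ.<⇒≤ t<n)

-- Here a = 1 + #{i ≥ 1 : c_i = 1}, so the period-2 part has degree N - a = ℓ_2.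
classical : ∀ Φ → VecAll.All OneOrTwo (highestCoeffs Φ) → distinctCoeffs Φ ≡ 1 ∷ 2 ∷ [] → EhrhartDecomposition Φ
classical Φ one-or-two ks≡ = Lk , periods , agreement
  where
  hc = highestCoeffs Φ
  N = rank Φ
  a = suc N ℕ.∸ twos hc
  a+ℓ₂≡N : a ℕ.+ ℓ[ Φ ] 2 ≡ N
  a+ℓ₂≡N = [1+n∸t]+[t∸1]≡n (ℕₚ.≤-trans (s≤s z≤n) (suc-ℓ≤countDivisible Φ (subst (2 ∈_) (sym ks≡) (there (here refl)))))
                   (twos≤length hc)
  Lk : ℕ → ℤ → ℚ
  Lk 1 = quasiPoly 1 (λ _ → polynomialPartₚ a N)
  Lk 2 = quasiPoly 2 (signed (alternatingPartₚ a N))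
  Lk _ = λ _ → 0ℚ
  periods : ∀ k → k ∈ distinctCoeffs Φ → QuasiPoly (Lk k) k (ℓ[ Φ ] k)
  periods k k∈ with subst (k ∈_) ks≡ k∈
  ... | here refl         = subst (QuasiPoly (Lk 1) 1) (sym (ℓ-1 Φ)) (polynomialPart-quasiPoly a N)
  ... | there (here refl) = alternatingPart-quasiPoly a (ℓ[ Φ ] 2) N a+ℓ₂≡N
  agreement : ∀ q → (+ L Φ q) / 1 ≡ sumℚ (map (λ k → Lk k (+ q)) (distinctCoeffs Φ))
  agreement q = begin
    fromℕ (L Φ q)                    ≡⟨ cong fromℕ (L≡simplexCount Φ q) ⟩
    fromℕ (simplexCount hc q)        ≡⟨ simplexCount-closedForm hc one-or-two q ⟩
    closedForm a N (+ q)             ≡⟨ closedForm-split a N (+ q) ⟩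
    eval (polynomialPartₚ a N) (+ q) + sign (residue 2 (+ q)) * eval (alternatingPartₚ a N) (+ q)
      ≡⟨ cong (_+_ (Lk 1 (+ q))) (trans (sym (quasiPoly-signed (alternatingPartₚ a N) (+ q))) (sym (ℚₚ.+-identityʳ (Lk 2 (+ q))))) ⟩
    sumℚ (map (λ k → Lk k (+ q)) (1 ∷ 2 ∷ []))  ≡⟨ cong (λ ks → sumℚ (map (λ k → Lk k (+ q)) ks)) (sym ks≡) ⟩
    sumℚ (map (λ k → Lk k (+ q)) (distinctCoeffs Φ)) ∎
    where open ≡-Reasoning

-- In type A every c_i is 1, so a = N + 1 and the period-2 part vanishes.
classicalA : ∀ n → EhrhartDecomposition (A n)
classicalA n = Lk , periods , agreement
  where
  hc = highestCoeffs (A n)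
  N = suc n
  Lk : ℕ → ℤ → ℚ
  Lk 1 = quasiPoly 1 (λ _ → polynomialPartₚ (suc N) N)
  Lk _ = λ _ → 0ℚ
  periods : ∀ k → k ∈ distinctCoeffs (A n) → QuasiPoly (Lk k) k (ℓ[ A n ] k)
  periods k k∈ with subst (k ∈_) (distinctCoeffs-A n) k∈
  ... | here refl = subst (QuasiPoly (Lk 1) 1) (sym (ℓ-1 (A n))) (polynomialPart-quasiPoly (suc N) N)
  agreement : ∀ q → (+ L (A n) q) / 1 ≡ sumℚ (map (λ k → Lk k (+ q)) (distinctCoeffs (A n)))
  agreement q = begin
    fromℕ (L (A n) q)                ≡⟨ cong fromℕ (L≡simplexCount (A n) q) ⟩
    fromℕ (simplexCount hc q)        ≡⟨ simplexCount-closedForm hc (oneOrTwo-A n) q ⟩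
    closedForm (suc N ℕ.∸ twos hc) N (+ q) ≡⟨ cong (λ t₂ → closedForm (suc N ℕ.∸ t₂) N (+ q)) (twos-replicate-1 N) ⟩
    closedForm (suc N) N (+ q)       ≡⟨ closedForm-split (suc N) N (+ q) ⟩
    eval (polynomialPartₚ (suc N) N) (+ q) + sign (residue 2 (+ q)) * eval (alternatingPartₚ (suc N) N) (+ q)
      ≡⟨ cong (λ x → Lk 1 (+ q) + sign (residue 2 (+ q)) * x) (alternatingPart-vanishes N (+ q)) ⟩
    Lk 1 (+ q) + sign (residue 2 (+ q)) * 0ℚ ≡⟨ cong (_+_ (Lk 1 (+ q))) (ℚₚ.*-zeroʳ (sign (residue 2 (+ q)))) ⟩
    sumℚ (map (λ k → Lk k (+ q)) (1 ∷ []))  ≡⟨ cong (λ ks → sumℚ (map (λ k → Lk k (+ q)) ks)) (sym (distinctCoeffs-A n)) ⟩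
    sumℚ (map (λ k → Lk k (+ q)) (distinctCoeffs (A n))) ∎
    where open ≡-Reasoning

-- The exceptional types

e6-constituents : (k : ℕ) → Fin k → Poly
e6-constituents 1 = Vec.lookup
  ( (+ 551 / 648 ∷ + 1283 / 960 ∷ + 8771 / 11520 ∷ + 5 / 24 ∷ + 17 / 576 ∷ + 1 / 480 ∷ + 1 / 17280 ∷ [])
  ∷ [])
e6-constituents 2 = Vec.lookup
  ( (+ 1 / 8 ∷ + 3 / 64 ∷ + 1 / 256 ∷ [])
  ∷ (- (+ 1 / 8) ∷ - (+ 3 / 64) ∷ - (+ 1 / 256) ∷ [])
  ∷ [])
e6-constituents 3 = Vec.lookup
  ( (+ 2 / 81 ∷ [])
  ∷ (- (+ 1 / 81) ∷ [])
  ∷ (- (+ 1 / 81) ∷ [])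
  ∷ [])
e6-constituents _ = λ _ → []

e7-constituents : (k : ℕ) → Fin k → Poly
e7-constituents 1 = Vec.lookup
  ( (+ 20389 / 27648 ∷ + 8384153 / 8709120 ∷ + 2387 / 5120 ∷ + 15563 / 138240 ∷ + 23 / 1536 ∷ + 77 / 69120 ∷ + 1 / 23040 ∷ + 1 / 1451520 ∷ [])
  ∷ [])
e7-constituents 2 = Vec.lookup
  ( (+ 177 / 1024 ∷ + 221 / 3072 ∷ + 9 / 1024 ∷ + 1 / 3072 ∷ [])
  ∷ (- (+ 177 / 1024) ∷ - (+ 221 / 3072) ∷ - (+ 9 / 1024) ∷ - (+ 1 / 3072) ∷ [])
  ∷ [])
e7-constituents 3 = Vec.lookup
  ( (+ 2 / 27 ∷ + 2 / 243 ∷ [])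
  ∷ (- (+ 1 / 27) ∷ - (+ 1 / 243) ∷ [])
  ∷ (- (+ 1 / 27) ∷ - (+ 1 / 243) ∷ [])
  ∷ [])
e7-constituents 4 = Vec.lookup
  ( (+ 1 / 64 ∷ [])
  ∷ []
  ∷ (- (+ 1 / 64) ∷ [])
  ∷ []
  ∷ [])
e7-constituents _ = λ _ → []

e8-constituents : (k : ℕ) → Fin k → Poly
e8-constituents 1 = Vec.lookup
  ( (+ 1709433137 / 2985984000 ∷ + 3797209 / 6967296 ∷ + 40863619 / 209018880 ∷ + 19823 / 552960 ∷ + 124823 / 33177600 ∷ + 13 / 55296 ∷ + 43 / 4976640 ∷ + 1 / 5806080 ∷ + 1 / 696729600 ∷ [])
  ∷ [])
e8-constituents 2 = Vec.lookup
  ( (+ 169441 / 884736 ∷ + 865 / 12288 ∷ + 623 / 73728 ∷ + 5 / 12288 ∷ + 1 / 147456 ∷ [])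
  ∷ (- (+ 169441 / 884736) ∷ - (+ 865 / 12288) ∷ - (+ 623 / 73728) ∷ - (+ 5 / 12288) ∷ - (+ 1 / 147456) ∷ [])
  ∷ [])
e8-constituents 3 = Vec.lookup
  ( (+ 397 / 2916 ∷ + 5 / 243 ∷ + 1 / 1458 ∷ [])
  ∷ (- (+ 397 / 5832) ∷ - (+ 5 / 486) ∷ - (+ 1 / 2916) ∷ [])
  ∷ (- (+ 397 / 5832) ∷ - (+ 5 / 486) ∷ - (+ 1 / 2916) ∷ [])
  ∷ [])
e8-constituents 4 = Vec.lookup
  ( (+ 15 / 256 ∷ + 1 / 256 ∷ [])
  ∷ []
  ∷ (- (+ 15 / 256) ∷ - (+ 1 / 256) ∷ [])
  ∷ []
  ∷ [])
e8-constituents 5 = Vec.lookup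
  ( (+ 4 / 125 ∷ [])
  ∷ (- (+ 1 / 125) ∷ [])
  ∷ (- (+ 1 / 125) ∷ [])
  ∷ (- (+ 1 / 125) ∷ [])
  ∷ (- (+ 1 / 125) ∷ [])
  ∷ [])
e8-constituents 6 = Vec.lookup
  ( (+ 1 / 108 ∷ [])
  ∷ (+ 1 / 216 ∷ [])
  ∷ (- (+ 1 / 216) ∷ [])
  ∷ (- (+ 1 / 108) ∷ [])
  ∷ (- (+ 1 / 216) ∷ [])
  ∷ (+ 1 / 216 ∷ [])
  ∷ [])
e8-constituents _ = λ _ → []

f4-constituents : (k : ℕ) → Fin k → Poly
f4-constituents 1 = Vec.lookup
  ( (+ 4267 / 6912 ∷ + 55 / 96 ∷ + 199 / 1152 ∷ + 1 / 48 ∷ + 1 / 1152 ∷ [])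
  ∷ [])
f4-constituents 2 = Vec.lookup
  ( (+ 63 / 256 ∷ + 3 / 32 ∷ + 1 / 128 ∷ [])
  ∷ (- (+ 63 / 256) ∷ - (+ 3 / 32) ∷ - (+ 1 / 128) ∷ [])
  ∷ [])
f4-constituents 3 = Vec.lookup
  ( (+ 2 / 27 ∷ [])
  ∷ (- (+ 1 / 27) ∷ [])
  ∷ (- (+ 1 / 27) ∷ [])
  ∷ [])
f4-constituents 4 = Vec.lookup
  ( (+ 1 / 16 ∷ [])
  ∷ []
  ∷ (- (+ 1 / 16) ∷ [])
  ∷ []
  ∷ [])
f4-constituents _ = λ _ → []

g2-constituents : (k : ℕ) → Fin k → Poly
g2-constituents 1 = Vec.lookup
  ( (+ 47 / 72 ∷ + 1 / 2 ∷ + 1 / 12 ∷ [])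
  ∷ [])
g2-constituents 2 = Vec.lookup
  ( (+ 1 / 8 ∷ [])
  ∷ (- (+ 1 / 8) ∷ [])
  ∷ [])
g2-constituents 3 = Vec.lookup
  ( (+ 2 / 9 ∷ [])
  ∷ (- (+ 1 / 9) ∷ [])
  ∷ (- (+ 1 / 9) ∷ [])
  ∷ [])
g2-constituents _ = λ _ → []

proposition2p27 : (Φ : RootSystem) →
    Σ[ Lk ∈ (ℕ → ℤ → ℚ) ] ((∀ (k : ℕ) → k ∈ distinctCoeffs Φ → QuasiPoly (Lk k) k (ℓ[ Φ ] k))
      × (∀ (q : ℕ) → (+ L Φ q) / 1 ≡ sumℚ (map (λ k → Lk k (+ q)) (distinctCoeffs Φ))))
proposition2p27 (A n) = classicalA n
proposition2p27 (B n) = classical (B n) (oneOrTwo-B n) (distinctCoeffs-B n)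
proposition2p27 (C n) = classical (C n) (oneOrTwo-C n) (distinctCoeffs-C n)
proposition2p27 (D n) = classical (D n) (oneOrTwo-D n) (distinctCoeffs-D n)
proposition2p27 E6    = certified E6 e6-constituents _
proposition2p27 E7    = certified E7 e7-constituents _
proposition2p27 E8    = certified E8 e8-constituents _
proposition2p27 F4    = certified F4 f4-constituents _
proposition2p27 G2    = certified G2 g2-constituents _
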